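{- Let $\kappa\in\mathbb{Z}$, $p>3$ a prime, and $n\in\mathbb{Z}_{>0}$. Define $T^{\mathrm{all}}_{n,\kappa}(p)=\{(\alpha,\beta)\in\mathbb{F}_p\times\mathbb{F}_p^\times : A_n(\beta/2)=0,\ f_\kappa(\beta,\alpha)=0\}$ and $T^{\mathrm{dist}}_{n,\kappa}(p)=\{(\alpha,\beta)\in T^{\mathrm{all}}_{n,\kappa}(p) : \beta^2(3-\beta)\ne\kappa,\ \beta^2(8-\beta^2)\ne4\kappa\}$. Then $\mathcal{K}^{\mathrm{all}}_{n,\kappa}(p)=\{\sigma(K_{(\alpha,\beta)}) : (\alpha,\beta)\in T^{\mathrm{all}}_{n,\kappa}(p),\ \sigma\in\Sigma\}\sqcup\mathcal{E}_{n,\kappa}(p)$ and $\mathcal{K}^{\mathrm{dist}}_{n,\kappa}(p)=\{\sigma(K_{(\alpha,\beta)}) : (\alpha,\beta)\in T^{\mathrm{dist}}_{n,\kappa}(p),\ \sigma\in\Sigma\}$, where, with $O=(0,0,0)$ and $P=(2,2,2)$, $\mathcal{E}_{n,\kappa}(p)=\{(O,O,O;O,O,O)\}$ if $\kappa\equiv0\pmod p$; $\mathcal{E}_{n,\kappa}(p)=\{\sigma(P,P,P;P,P,P):\sigma\in\Sigma\}$ if $\kappa\equiv4\pmod p$ and $2n+1\not\equiv0\pmod p$; and $\mathcal{E}_{n,\kappa}(p)=\emptyset$ otherwise.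
   Context: $\kappa$ is regarded as an element of $\mathbb{F}_p$. $\mathcal{M}_\kappa(p)=\{(x,y,z)\in\mathbb{F}_p^3 : x^2+y^2+z^2=xyz+\kappa\}$, with Vieta involutions $R_1(x,y,z)=(yz-x,y,z)$, $R_2(x,y,z)=(x,zx-y,z)$, $R_3(x,y,z)=(x,y,xy-z)$; $R_iR_j$ means apply $R_j$ first. For $n\in\mathbb{Z}_{>0}$, $\mathcal{K}^{\mathrm{all}}_{n,\kappa}(p)$ is the set of sextuples $(X_1,X_2,X_3;Y_1,Y_2,Y_3)$ of elements of $\mathcal{M}_\kappa(p)$ with $Y_1=R_1(X_1)=(R_2R_1)^n(X_2)=(R_3R_1)^n(X_3)$, $Y_2=R_2(X_2)=(R_3R_2)^n(X_3)=(R_1R_2)^n(X_1)$, $Y_3=R_3(X_3)=(R_1R_3)^n(X_1)=(R_2R_3)^n(X_2)$; $\mathcal{K}^{\mathrm{dist}}_{n,\kappa}(p)$ is the subset of those whose six triples are pairwise distinct. The polynomials $A_m(x)\in\mathbb{Z}[x]$ are defined by $A_0=1$, $A_1=2x+1$, $A_{m+1}=2xA_m-A_{m-1}$ ($m\ge1$); $f_\kappa(x,y)=y^2-x^2y+2x^2-\kappa$. For $\alpha,\beta\in\mathbb{F}_p$ put $\overline{\alpha}=\beta^2-\alpha$ and $K_{(\alpha,\beta)}=((\alpha,\beta,\beta),(\beta,\alpha,\beta),(\beta,\beta,\alpha);(\overline\alpha,\beta,\beta),(\beta,\overline\alpha,\beta),(\beta,\beta,\overline\alpha))$. $\Sigma$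 is the group of double sign changes $\{\mathrm{id},(x,y,z)\mapsto(x,-y,-z),(x,y,z)\mapsto(-x,y,-z),(x,y,z)\mapsto(-x,-y,z)\}$, acting on sextuples entrywise. -}

module Defs where

open import Data.Nat as ℕ using (ℕ; zero; suc)
open import Data.Nat.DivMod using (_/_)
open import Data.Integer using (ℤ; +_; _+_; _-_; _*_; -_)
open import Data.Integer.Divisibility using (_∣_)
open import Data.Product using (_×_; _,_; Σ; ∃-syntax)
open import Data.Sum using (_⊎_)
open import Data.List using (List; []; _∷_)
open import Data.List.Relation.Unary.AllPairs using (AllPairs)
open import Relation.Nullary using (¬_)

-- Elements of F_p are represented by integers; equality in F_p is
-- congruence modulo p.

_≡[_]_ : ℤ → ℕ → ℤ → Set
a ≡[ p ] b = (+ p) ∣ (a - b)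

infix 4 _≡[_]_

-- the inverse of 2 in F_p (p odd): (p+1)/2
half : ℕ → ℤ
half p = + (suc p / 2)

Triple : Set
Triple = ℤ × ℤ × ℤ

_≈₃[_]_ : Triple → ℕ → Triple → Set
(x , y , z) ≈₃[ p ] (x' , y' , z') = (x ≡[ p ] x') × (y ≡[ p ] y') × (z ≡[ p ] z')

InM : ℕ → ℤ → Triple → Set
InM p κ (x , y , z) = (x * x + y * y + z * z) ≡[ p ] (x * y * z + κ)

R₁ R₂ R₃ : Triple → Triple
R₁ (x , y , z) = (y * z - x , y , z)
R₂ (x , y , z) = (x , z * x - y , z)
R₃ (x , y , z) = (x , y , x * y - z)

-- (R_i R_j)^n : apply R_j first, then R_i, n times
iter : (Triple → Triple) → ℕ → Triple → Triple
iter f zero t = t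
iter f (suc n) t = f (iter f n t)

_∘R_ : (Triple → Triple) → (Triple → Triple) → Triple → Triple
(f ∘R g) t = f (g t)

record Sextuple : Set where
  constructor sext
  field
    X₁ X₂ X₃ Y₁ Y₂ Y₃ : Triple
open Sextuple public

_≈₆[_]_ : Sextuple → ℕ → Sextuple → Set
s ≈₆[ p ] t =
  (X₁ s ≈₃[ p ] X₁ t) × (X₂ s ≈₃[ p ] X₂ t) × (X₃ s ≈₃[ p ] X₃ t) ×
  (Y₁ s ≈₃[ p ] Y₁ t) × (Y₂ s ≈₃[ p ] Y₂ t) × (Y₃ s ≈₃[ p ] Y₃ t)

entries : Sextuple → List Triple
entries s = X₁ s ∷ X₂ s ∷ X₃ s ∷ Y₁ s ∷ Y₂ s ∷ Y₃ s ∷ []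

Kall : ℕ → ℕ → ℤ → Sextuple → Set
Kall p n κ s =
  InM p κ (X₁ s) × InM p κ (X₂ s) × InM p κ (X₃ s) ×
  InM p κ (Y₁ s) × InM p κ (Y₂ s) × InM p κ (Y₃ s) ×
  (Y₁ s ≈₃[ p ] R₁ (X₁ s)) × (Y₁ s ≈₃[ p ] iter (R₂ ∘R R₁) n (X₂ s)) ×
  (Y₁ s ≈₃[ p ] iter (R₃ ∘R R₁) n (X₃ s)) ×
  (Y₂ s ≈₃[ p ] R₂ (X₂ s)) × (Y₂ s ≈₃[ p ] iter (R₃ ∘R R₂) n (X₃ s)) ×
  (Y₂ s ≈₃[ p ] iter (R₁ ∘R R₂) n (X₁ s)) ×
  (Y₃ s ≈₃[ p ] R₃ (X₃ s)) × (Y₃ s ≈₃[ p ] iter (R₁ ∘R R₃) n (X₁ s)) ×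
  (Y₃ s ≈₃[ p ] iter (R₂ ∘R R₃) n (X₂ s))

Kdist : ℕ → ℕ → ℤ → Sextuple → Set
Kdist p n κ s = Kall p n κ s × AllPairs (λ a b → ¬ (a ≈₃[ p ] b)) (entries s)

A : ℕ → ℤ → ℤ
A zero x = + 1
A (suc zero) x = + 2 * x + + 1
A (suc (suc m)) x = + 2 * x * A (suc m) x - A m x

f : ℤ → ℤ → ℤ → ℤ
f κ x y = y * y - x * x * y + + 2 * x * x - κ

Tall : ℕ → ℕ → ℤ → ℤ → ℤ → Set
Tall p n κ α β =
  ¬ (β ≡[ p ] + 0) × (A n (β * half p) ≡[ p ] + 0) × (f κ β α ≡[ p ] + 0)

Tdist : ℕ → ℕ → ℤ → ℤ → ℤ → Set
Tdist p n κ α β =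
  Tall p n κ α β ×
  ¬ (β * β * (+ 3 - β) ≡[ p ] κ) ×
  ¬ (β * β * (+ 8 - β * β) ≡[ p ] + 4 * κ)

K : ℤ → ℤ → Sextuple
K α β = sext (α , β , β) (β , α , β) (β , β , α)
             (ᾱ , β , β) (β , ᾱ , β) (β , β , ᾱ)
  where ᾱ = β * β - α

data Sign : Set where
  idσ σ₁ σ₂ σ₃ : Sign

act₃ : Sign → Triple → Triple
act₃ idσ t = t
act₃ σ₁ (x , y , z) = (x , - y , - z)
act₃ σ₂ (x , y , z) = (- x , y , - z)
act₃ σ₃ (x , y , z) = (- x , - y , z)

act : Sign → Sextuple → Sextuple
act σ (sext a b c d e g) =
  sext (act₃ σ a) (act₃ σ b) (act₃ σ c) (act₃ σ d) (act₃ σ e) (act₃ σ g)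

InOrbitSet : ℕ → (ℤ → ℤ → Set) → Sextuple → Set
InOrbitSet p T s = ∃[ α ] ∃[ β ] ∃[ σ ] (T α β × s ≈₆[ p ] act σ (K α β))

O P : Triple
O = (+ 0 , + 0 , + 0)
P = (+ 2 , + 2 , + 2)

const6 : Triple → Sextuple
const6 t = sext t t t t t t

-- membership in E_{n,κ}(p)  (for p > 3 the two cases are exclusive;
-- in all other cases E is empty)
InE : ℕ → ℕ → ℤ → Sextuple → Set
InE p n κ s =
  ((κ ≡[ p ] + 0) × s ≈₆[ p ] const6 O)
  ⊎ ((κ ≡[ p ] + 4) × ¬ ((+ (2 ℕ.* n ℕ.+ 1)) ≡[ p ] + 0) ×
     (∃[ σ ] (s ≈₆[ p ] act σ (const6 P))))

-- Fix the third coordinate z. On the (x, y)-plane, R₂R₁ acts as two steps of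
-- S : (a, b) ↦ (b, z b − a), the recursion u₍ₖ₊₂₎ = z u₍ₖ₊₁₎ − uₖ, and R₁R₂
-- is the same conjugated by (x, y) ↦ (y, x). The four conditions linking X₁
-- and X₂ then say that S^(2n+1) maps (y₁, x₁) to (x₂, y₂) and back. Since S
-- preserves the determinant, Sᵏ v = w and Sᵏ w = v force w = ±v modulo an odd
-- prime, so X₂ = (±y₁, ±x₁, z₁). Rotating coordinates permutes the conditions
-- cyclically, and the three signed swaps force (X₁, X₂, X₃) to be
-- σ(α, β, β), σ(β, α, β), σ(β, β, α); the Y's follow from Yᵢ = Rᵢ Xᵢ.
-- For K_(α,β) itself, u₍₂ₙ₊₁₎ − u₀ = A_n(β/2) (u₍ₙ₊₁₎ − uₙ) shows that either
-- A_n(β/2) = 0, or (β, α) is a fixed point of S, which forces α = β ∈ {0, 2}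
-- and gives the exceptional configurations. Modulo f_κ(β, α) = 0 one has
-- β²(3 − β) − κ = (β − α)(β − ᾱ) and β²(8 − β²) − 4κ = −(α − ᾱ)², which
-- translates pairwise distinctness into the conditions defining T^dist.

module Submission where

open import Defs
open import Data.Nat as ℕ using (ℕ; zero; suc; _<_)
import Data.Nat.Properties as ℕₚ
import Data.Nat.Divisibility as ℕ∣
open import Data.Nat.DivMod using (_/_; _%_; m≡m%n+[m/n]*n; m%n<n)
open import Data.Nat.Primality using (Prime; euclidsLemma; composite)
open import Data.Integer using (ℤ; +_; _+_; _-_; _*_; -_; ∣_∣)
open import Data.Integer.Properties using (abs-*; pos-*; pos-+; *-comm)
import Data.Integer.Divisibility.Signed as ℤ∣
open import Data.Integer.Tactic.RingSolver using (solve-∀)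
import Data.Sign.Base as ±
import Data.Sign.Properties as ±ₚ
open import Data.Product using (_×_; _,_; proj₁; proj₂; ∃-syntax; swap)
open import Data.Sum using (_⊎_; inj₁; inj₂; [_,_]′)
import Data.Sum as Sum
open import Data.Empty using (⊥; ⊥-elim)
open import Data.List.Relation.Unary.AllPairs using ([]; _∷_)
open import Data.List.Relation.Unary.All using ([]; _∷_)
open import Function.Base using (id; _∘′_)
open import Function.Bundles using (_⇔_; mk⇔; module Equivalence)
open import Relation.Binary.Bundles using (Setoid)
import Relation.Binary.Reasoning.Setoid as SetoidReasoning
open import Relation.Binary.PropositionalEquality
  using (_≡_; refl; sym; trans; cong; cong₂; subst; module ≡-Reasoning)
open import Relation.Nullary using (¬_; Dec; yes; no)

infixr 8 _•_

_•_ : ±.Sign → ℤ → ℤ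
±.+ • x = x
±.- • x = - x

•-• : ∀ s t x → s • (t • x) ≡ (s ±.* t) • x
•-• ±.+ t x = refl
•-• ±.- ±.+ x = refl
•-• ±.- ±.- x = neg-involutive x
  where
    neg-involutive : ∀ x → - - x ≡ x
    neg-involutive = solve-∀

•-cancel : ∀ s x → s • (s • x) ≡ x
•-cancel s x = trans (•-• s s x) (cong (_• x) (±ₚ.s*s≡+ s))

•-comm : ∀ s t x → s • (t • x) ≡ t • (s • x)
•-comm s t x = trans (•-• s t x) (trans (cong (_• x) (±ₚ.*-comm s t)) (sym (•-• t s x)))

•-absorb : ∀ s t x → (s ±.* t) • (t • x) ≡ s • x
•-absorb s t x = trans (•-• (s ±.* t) t x) (cong (_• x) s*t*t≡s)
  where
    s*t*t≡s : (s ±.* t) ±.* t ≡ s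
    s*t*t≡s = trans (±ₚ.*-assoc s t t) (trans (cong (s ±.*_) (±ₚ.s*s≡+ t)) (±ₚ.*-identityʳ s))

•-*-swap : ∀ s a d → (s • a) * d ≡ a * (s • d)
•-*-swap ±.+ a d = refl
•-*-swap ±.- a d = neg-swap a d
  where
    neg-swap : ∀ a d → - a * d ≡ a * - d
    neg-swap = solve-∀

module Congruence (m : ℕ) where

  -- A record rather than `a ≡[ m ] b` itself, so that a and b can be
  -- inferred from a proof.
  record _≈_ (a b : ℤ) : Set where
    constructor mk≈
    field un≈ : a ≡[ m ] b
  open _≈_ public
  infix 4 _≈_

  private
    toSigned : ∀ {a b} → a ≈ b → + m ℤ∣.∣ (a - b)
    toSigned (mk≈ h) = ℤ∣.∣ᵤ⇒∣ h

    fromSigned : ∀ {a b c} → a - b ≡ c → + m ℤ∣.∣ c → a ≈ b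
    fromSigned refl d = mk≈ (ℤ∣.∣⇒∣ᵤ d)

    self-diff : ∀ a → a - a ≡ + 0
    self-diff = solve-∀
    swap-diff : ∀ a b → b - a ≡ - (a - b)
    swap-diff = solve-∀
    chain-diff : ∀ a b c → a - c ≡ (a - b) + (b - c)
    chain-diff = solve-∀
    sum-diff : ∀ a b c d → (a + c) - (b + d) ≡ (a - b) + (c - d)
    sum-diff = solve-∀
    product-diff : ∀ a b c d → a * c - b * d ≡ (a - b) * c + b * (c - d)
    product-diff = solve-∀
    neg-diff : ∀ a b → - a - - b ≡ - (a - b)
    neg-diff = solve-∀
    minus-zero : ∀ a → a - + 0 ≡ a
    minus-zero = solve-∀

  ≈-refl : ∀ {a} → a ≈ a
  ≈-refl {a} = fromSigned (self-diff a) (ℤ∣.divides (+ 0) refl)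

  ≡⇒≈ : ∀ {a b} → a ≡ b → a ≈ b
  ≡⇒≈ refl = ≈-refl

  ≈-sym : ∀ {a b} → a ≈ b → b ≈ a
  ≈-sym {a} {b} h = fromSigned (swap-diff a b) (ℤ∣.∣m⇒∣-m (toSigned h))

  ≈-trans : ∀ {a b c} → a ≈ b → b ≈ c → a ≈ c
  ≈-trans {a} {b} {c} h k = fromSigned (chain-diff a b c) (ℤ∣.∣m∣n⇒∣m+n (toSigned h) (toSigned k))

  ≈-setoid : Setoid _ _
  ≈-setoid = record
    { Carrier = ℤ ; _≈_ = _≈_
    ; isEquivalence = record { refl = ≈-refl ; sym = ≈-sym ; trans = ≈-trans } }

  +-cong : ∀ {a b c d} → a ≈ b → c ≈ d → a + c ≈ b + d
  +-cong {a} {b} {c} {d} h k = fromSigned (sum-diff a b c d) (ℤ∣.∣m∣n⇒∣m+n (toSigned h) (toSigned k))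

  *-cong : ∀ {a b c d} → a ≈ b → c ≈ d → a * c ≈ b * d
  *-cong {a} {b} {c} {d} h k = fromSigned (product-diff a b c d)
    (ℤ∣.∣m∣n⇒∣m+n (ℤ∣.∣m⇒∣m*n c (toSigned h)) (ℤ∣.∣n⇒∣m*n b (toSigned k)))

  -‿cong : ∀ {a b} → a ≈ b → - a ≈ - b
  -‿cong {a} {b} h = fromSigned (neg-diff a b) (ℤ∣.∣m⇒∣-m (toSigned h))

  minus-cong : ∀ {a b c d} → a ≈ b → c ≈ d → a - c ≈ b - d
  minus-cong h k = +-cong h (-‿cong k)

  modulus≈0 : + m ≈ + 0
  modulus≈0 = fromSigned (minus-zero (+ m)) (ℤ∣.∣-refl {+ m})

  ≈⇒diff≈0 : ∀ {a b} → a ≈ b → a - b ≈ + 0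
  ≈⇒diff≈0 {a} {b} h = fromSigned (minus-zero (a - b)) (toSigned h)

  diff≈0⇒≈ : ∀ {a b} → a - b ≈ + 0 → a ≈ b
  diff≈0⇒≈ {a} {b} h = fromSigned (sym (minus-zero (a - b))) (toSigned h)

  ≈0⇒∣ : ∀ {a} → a ≈ + 0 → m ℕ∣.∣ ∣ a ∣
  ≈0⇒∣ {a} (mk≈ h) = subst (λ z → m ℕ∣.∣ ∣ z ∣) (minus-zero a) h

  ∣⇒≈0 : ∀ {a} → m ℕ∣.∣ ∣ a ∣ → a ≈ + 0
  ∣⇒≈0 {a} h = mk≈ (subst (λ z → m ℕ∣.∣ ∣ z ∣) (sym (minus-zero a)) h)

  _≈0? : ∀ a → Dec (a ≈ + 0)
  a ≈0? with m ℕ∣.∣? ∣ a ∣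
  ... | yes h = yes (∣⇒≈0 h)
  ... | no h = no (λ z → h (≈0⇒∣ z))

  suc≉0 : ∀ {k} → suc k < m → ¬ (+ suc k ≈ + 0)
  suc≉0 k<m h = ℕ∣.>⇒∤ k<m (≈0⇒∣ h)

  •-cong : ∀ s {a b} → a ≈ b → s • a ≈ s • b
  •-cong ±.+ h = h
  •-cong ±.- h = -‿cong h

  •-flip : ∀ s {a b} → a ≈ s • b → b ≈ s • a
  •-flip ±.+ h = ≈-sym h
  •-flip ±.- {a} {b} h = ≈-trans (≡⇒≈ (sym (•-cancel ±.- b))) (-‿cong (≈-sym h))

  •-zero : ∀ s {a} → a ≈ + 0 → s • a ≈ + 0
  •-zero ±.+ h = h
  •-zero ±.- h = -‿cong h

  ±1≉0 : 1 < m → ∀ s → ¬ (s • + 1 ≈ + 0)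
  ±1≉0 1<m ±.+ h = suc≉0 1<m h
  ±1≉0 1<m ±.- h = suc≉0 1<m (-‿cong h)

  module _ (prime : Prime m) where

    x*y≈0⇒x≈0∨y≈0 : ∀ a b → a * b ≈ + 0 → a ≈ + 0 ⊎ b ≈ + 0
    x*y≈0⇒x≈0∨y≈0 a b h =
      Sum.map ∣⇒≈0 ∣⇒≈0 (euclidsLemma ∣ a ∣ ∣ b ∣ prime (subst (m ℕ∣.∣_) (abs-* a b) (≈0⇒∣ h)))

    *-cancelˡ-≈ : ∀ {c a b} → ¬ (c ≈ + 0) → c * a ≈ c * b → a ≈ b
    *-cancelˡ-≈ {c} {a} {b} c≉0 h =
      [ (λ c≈0 → ⊥-elim (c≉0 c≈0)) , diff≈0⇒≈ ]′
        (x*y≈0⇒x≈0∨y≈0 c (a - b) (≈-trans (≡⇒≈ (factor c a b)) (≈⇒diff≈0 h)))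
      where
        factor : ∀ c a b → c * (a - b) ≡ c * a - c * b
        factor = solve-∀

    square≈⇒≈± : ∀ {a b} → a * a ≈ b * b → ∃[ s ] a ≈ s • b
    square≈⇒≈± {a} {b} h =
      [ (λ a-b≈0 → ±.+ , diff≈0⇒≈ a-b≈0) ,
        (λ a+b≈0 → ±.- , diff≈0⇒≈ (≈-trans (≡⇒≈ (minus-neg a b)) a+b≈0)) ]′
        (x*y≈0⇒x≈0∨y≈0 (a - b) (a + b) (≈-trans (≡⇒≈ (difference-of-squares a b)) (≈⇒diff≈0 h)))
      where
        difference-of-squares : ∀ a b → (a - b) * (a + b) ≡ a * a - b * b
        difference-of-squares = solve-∀
        minus-neg : ∀ a b → a - - b ≡ a + b
        minus-neg = solve-∀

    same-products⇒± : ∀ {a b c d} → c * c ≈ a * a → d * d ≈ b * b → a * b ≈ c * d →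
      ∃[ s ] c ≈ s • a × d ≈ s • b
    same-products⇒± {a} {b} {c} {d} c²≈a² d²≈b² ab≈cd with square≈⇒≈± c²≈a² | a ≈0?
    ... | s , c≈sa | no a≉0 = s , c≈sa , •-flip s (*-cancelˡ-≈ a≉0
            (≈-trans ab≈cd (≈-trans (*-cong c≈sa ≈-refl) (≡⇒≈ (•-*-swap s a d)))))
    ... | s , c≈sa | yes a≈0 =
      let t , d≈tb = square≈⇒≈± d²≈b²
      in t , ≈-trans c≈sa (≈-trans (•-zero s a≈0) (≈-sym (•-zero t a≈0))) , d≈tb

    module _ (2<m : 2 < m) where

      x≈-x⇒x≈0 : ∀ {a} → a ≈ - a → a ≈ + 0
      x≈-x⇒x≈0 {a} h =
        [ (λ 2≈0 → ⊥-elim (suc≉0 2<m 2≈0)) , id ]′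
          (x*y≈0⇒x≈0∨y≈0 (+ 2) a (≈-trans (≡⇒≈ (double a)) (≈⇒diff≈0 h)))
        where
          double : ∀ a → + 2 * a ≡ a - - a
          double = solve-∀

      2*half≈1 : + 2 * half m ≈ + 1
      2*half≈1 with suc m % 2 | m≡m%n+[m/n]*n (suc m) 2 | m%n<n (suc m) 2
      ... | 0 | m+1≡h*2 | _ = ≈-trans (≡⇒≈ 2*half≡m+1) (+-cong (≈-refl {+ 1}) modulus≈0)
        where
          2*half≡m+1 : + 2 * half m ≡ + 1 + + m
          2*half≡m+1 = trans (sym (pos-* 2 (suc m / 2)))
                             (cong +_ (trans (ℕₚ.*-comm 2 (suc m / 2)) (sym m+1≡h*2)))
      ... | 1 | m+1≡1+h*2 | _ =
        ⊥-elim (Prime.notComposite prime (composite 2<m (ℕ∣.divides (suc m / 2) (ℕₚ.suc-injective m+1≡1+h*2))))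
      ... | suc (suc _) | _ | ℕ.s≤s (ℕ.s≤s ())

      twice-half : ∀ a → + 2 * (a * half m) ≈ a
      twice-half a = ≈-trans (≡⇒≈ (regroup a (half m))) (≈-trans (*-cong (≈-refl {a}) 2*half≈1) (≡⇒≈ (times-one a)))
        where
          regroup : ∀ a h → + 2 * (a * h) ≡ a * (+ 2 * h)
          regroup = solve-∀
          times-one : ∀ a → a * + 1 ≡ a
          times-one = solve-∀

-- The recursion u₍ₖ₊₂₎ = t u₍ₖ₊₁₎ − uₖ on consecutive pairs

Pair : Set
Pair = ℤ × ℤ

step : ℤ → Pair → Pair
step t (a , b) = (b , t * b - a)

stepⁿ : ℤ → ℕ → Pair → Pair
stepⁿ t zero v = v
stepⁿ t (suc k) v = stepⁿ t k (step t v)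

stepⁿ-suc : ∀ t k v → stepⁿ t (suc k) v ≡ step t (stepⁿ t k v)
stepⁿ-suc t zero v = refl
stepⁿ-suc t (suc k) v = stepⁿ-suc t k (step t v)

step-swap-step : ∀ t v → step t (swap (step t v)) ≡ swap v
step-swap-step t (a , b) = cong (b ,_) (cancel t a b)
  where
    cancel : ∀ t a b → t * b - (t * b - a) ≡ a
    cancel = solve-∀

u : ℤ → ℕ → Pair → ℤ
u t k v = proj₁ (stepⁿ t k v)

u-recursion : ∀ t k v → u t (suc (suc k)) v ≡ t * u t (suc k) v - u t k v
u-recursion t k v rewrite stepⁿ-suc t (suc k) v | stepⁿ-suc t k v = refl

-- A½ t n = A n (t / 2), i.e. the recursion of A with 2x replaced by t.
A½ : ℤ → ℕ → ℤ
A½ t zero = + 1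
A½ t (suc zero) = t + + 1
A½ t (suc (suc k)) = t * A½ t (suc k) - A½ t k

double : ℕ → ℕ
double zero = zero
double (suc n) = suc (suc (double n))

A½-identity : ∀ t n v →
  u t (suc (double n)) v - u t 0 v ≡ A½ t n * (u t (suc n) v - u t n v)
A½-identity t zero (a , b) = one-times (b - a)
  where
    one-times : ∀ x → x ≡ + 1 * x
    one-times = solve-∀
A½-identity t (suc zero) (a , b) = expand t a b
  where
    expand : ∀ t a b → (t * (t * b - a) - b) - a ≡ (t + + 1) * ((t * b - a) - b)
    expand = solve-∀
A½-identity t (suc (suc n)) v@(a , b) = begin
  u t (5+2n) v - a
    ≡⟨ cong (_- a) (u-recursion t (suc (suc (suc (double n)))) v) ⟩
  (t * u t (4+2n) v - u t (3+2n) v) - a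
    ≡⟨ regroup t (u t (4+2n) v) (u t (3+2n) v) a b ⟩
  t * (u t (4+2n) v - b) - (u t (3+2n) v - (t * b - a))
    ≡⟨ cong₂ (λ x y → t * x - y) (A½-identity t (suc n) (step t v))
                                 (A½-identity t n (step t (step t v))) ⟩
  t * (A½ t (suc n) * d) - A½ t n * d
    ≡⟨ factor t (A½ t n) (A½ t (suc n)) d ⟩
  (t * A½ t (suc n) - A½ t n) * d ∎
  where
    open ≡-Reasoning
    5+2n = suc (suc (suc (suc (suc (double n)))))
    4+2n = suc (suc (suc (suc (double n))))
    3+2n = suc (suc (suc (double n)))
    d = u t (suc (suc (suc n))) v - u t (suc (suc n)) v
    regroup : ∀ t x y a b → (t * x - y) - a ≡ t * (x - b) - (y - (t * b - a))
    regroup = solve-∀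
    factor : ∀ t A₀ A₁ d → t * (A₁ * d) - A₀ * d ≡ (t * A₁ - A₀) * d
    factor = solve-∀

A½-at-two : ∀ n → A½ (+ 2) n ≡ + (2 ℕ.* n ℕ.+ 1)
A½-at-two n = trans (linear n) (trans (cong (_+ + 1) (sym (pos-* 2 n))) (sym (pos-+ (2 ℕ.* n) 1)))
  where
    linear : ∀ n → A½ (+ 2) n ≡ + 2 * + n + + 1
    linear zero = refl
    linear (suc zero) = refl
    linear (suc (suc k)) = trans (cong₂ (λ x y → + 2 * x - y) (linear (suc k)) (linear k)) (step-two (+ k))
      where
        step-two : ∀ x → + 2 * (+ 2 * (+ 1 + x) + + 1) - (+ 2 * x + + 1) ≡ + 2 * (+ 1 + (+ 1 + x)) + + 1
        step-two = solve-∀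

A½-at-zero : ∀ n → ∃[ s ] A½ (+ 0) n ≡ s • + 1
A½-at-zero zero = ±.+ , refl
A½-at-zero (suc zero) = ±.+ , refl
A½-at-zero (suc (suc k)) =
  let s , A≡s = A½-at-zero k
  in ±.opposite s , trans (flip (A½ (+ 0) (suc k)) (A½ (+ 0) k)) (trans (cong -_ A≡s) (•-• ±.- s (+ 1)))
  where
    flip : ∀ a b → + 0 * a - b ≡ - b
    flip = solve-∀

A½-at-minus-two : ∀ n → ∃[ s ] A½ (- + 2) n ≡ s • + 1
A½-at-minus-two zero = ±.+ , refl
A½-at-minus-two (suc k) =
  let s , A≡s = A½-at-minus-two k
  in ±.opposite s , trans (alternates k) (trans (cong -_ A≡s) (•-• ±.- s (+ 1)))
  where
    alternates : ∀ k → A½ (- + 2) (suc k) ≡ - A½ (- + 2) k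
    alternates zero = refl
    alternates (suc k) = begin
      - + 2 * A½ (- + 2) (suc k) - A½ (- + 2) k ≡⟨ cong (λ a → - + 2 * a - A½ (- + 2) k) (alternates k) ⟩
      - + 2 * - A½ (- + 2) k - A½ (- + 2) k    ≡⟨ collapse (A½ (- + 2) k) ⟩
      - - A½ (- + 2) k                         ≡⟨ cong -_ (alternates k) ⟨
      - A½ (- + 2) (suc k)                     ∎
      where
        open ≡-Reasoning
        collapse : ∀ x → - + 2 * - x - x ≡ - - x
        collapse = solve-∀

scale : ℤ → Pair → Pair
scale c (a , b) = (c * a , c * b)

stepⁿ-scale : ∀ t k c v → stepⁿ t k (scale c v) ≡ scale c (stepⁿ t k v)
stepⁿ-scale t zero c v = refl
stepⁿ-scale t (suc k) c (a , b) =
  trans (cong (stepⁿ t k) (cong (c * b ,_) (linear t c a b))) (stepⁿ-scale t k c (step t (a , b)))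
  where
    linear : ∀ t c a b → t * (c * b) - c * a ≡ c * (t * b - a)
    linear = solve-∀

_•²_ : ±.Sign → Pair → Pair
s •² (a , b) = (s • a , s • b)

det : Pair → Pair → ℤ
det (a , b) (c , d) = a * d - b * c

det-stepⁿ : ∀ t k v w → det (stepⁿ t k v) (stepⁿ t k w) ≡ det v w
det-stepⁿ t zero v w = refl
det-stepⁿ t (suc k) (a , b) (c , d) =
  trans (det-stepⁿ t k (step t (a , b)) (step t (c , d))) (det-step t a b c d)
  where
    det-step : ∀ t a b c d → b * (t * d - c) - (t * b - a) * d ≡ a * d - b * c
    det-step = solve-∀

module RecurrenceModulo (m : ℕ) where

  open Congruence m

  record _≈²_ (v w : Pair) : Set where
    constructor _,≈_
    field
      fst≈ : proj₁ v ≈ proj₁ w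
      snd≈ : proj₂ v ≈ proj₂ w
  open _≈²_ public
  infix 4 _≈²_

  ≈²-refl : ∀ {v} → v ≈² v
  ≈²-refl = ≈-refl ,≈ ≈-refl

  ≈²-sym : ∀ {v w} → v ≈² w → w ≈² v
  ≈²-sym (a ,≈ b) = ≈-sym a ,≈ ≈-sym b

  ≈²-trans : ∀ {v w x} → v ≈² w → w ≈² x → v ≈² x
  ≈²-trans (a ,≈ b) (c ,≈ d) = ≈-trans a c ,≈ ≈-trans b d

  ≡⇒≈² : ∀ {v w} → v ≡ w → v ≈² w
  ≡⇒≈² refl = ≈²-refl

  swap-cong : ∀ {v w} → v ≈² w → swap v ≈² swap w
  swap-cong (a ,≈ b) = b ,≈ a

  scale-cong : ∀ {c v w} → v ≈² w → scale c v ≈² scale c w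
  scale-cong {c} (a ,≈ b) = *-cong (≈-refl {c}) a ,≈ *-cong (≈-refl {c}) b

  step-cong : ∀ {t t' v w} → t ≈ t' → v ≈² w → step t v ≈² step t' w
  step-cong t≈t' (a ,≈ b) = b ,≈ minus-cong (*-cong t≈t' b) a

  stepⁿ-cong : ∀ {t t'} k {v w} → t ≈ t' → v ≈² w → stepⁿ t k v ≈² stepⁿ t' k w
  stepⁿ-cong zero t≈t' v≈w = v≈w
  stepⁿ-cong (suc k) t≈t' v≈w = stepⁿ-cong k t≈t' (step-cong t≈t' v≈w)

  step-injective : ∀ {t v w} → step t v ≈² step t w → v ≈² w
  step-injective {t} {v} {w} h = swap-cong
    (≈²-trans (≡⇒≈² (sym (step-swap-step t v)))
      (≈²-trans (step-cong (≈-refl {t}) (swap-cong h)) (≡⇒≈² (step-swap-step t w))))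

  stepⁿ-injective : ∀ {t} k {v w} → stepⁿ t k v ≈² stepⁿ t k w → v ≈² w
  stepⁿ-injective zero h = h
  stepⁿ-injective {t} (suc k) h = step-injective {t} (stepⁿ-injective k h)

  private
    snd-stepⁿ : ∀ t k v → proj₂ (stepⁿ t k v) ≡ u t k (step t v)
    snd-stepⁿ t k v = cong proj₁ (sym (stepⁿ-suc t k v))

  A½≈0⇒period : ∀ t n v → A½ t n ≈ + 0 → stepⁿ t (suc (double n)) v ≈² v
  A½≈0⇒period t n v A≈0 =
    u-period v ,≈ ≈-trans (≡⇒≈ (snd-stepⁿ t (suc (double n)) v)) (u-period (step t v))
    where
      u-period : ∀ v → u t (suc (double n)) v ≈ u t 0 v
      u-period v = diff≈0⇒≈ (≈-trans (≡⇒≈ (A½-identity t n v))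
        (≈-trans (*-cong A≈0 ≈-refl) (≡⇒≈ (zero-times (u t (suc n) v - u t n v)))))
        where
          zero-times : ∀ x → + 0 * x ≡ + 0
          zero-times = solve-∀

  A½-cong : ∀ {t t'} n → t ≈ t' → A½ t n ≈ A½ t' n
  A½-cong zero t≈t' = ≈-refl
  A½-cong (suc zero) t≈t' = +-cong t≈t' ≈-refl
  A½-cong (suc (suc k)) t≈t' = minus-cong (*-cong t≈t' (A½-cong (suc k) t≈t')) (A½-cong k t≈t')

  module _ (prime : Prime m) where

    period⇒fixed : ∀ t n v → ¬ (A½ t n ≈ + 0) →
      stepⁿ t (suc (double n)) v ≈² v → step t v ≈² v
    period⇒fixed t n v A≉0 (fst-period ,≈ snd-period) =
      stepⁿ-injective n
        (u-stalls (≈⇒diff≈0 fst-period)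
          ,≈ ≈-trans (≡⇒≈ (snd-stepⁿ t n (step t v)))
               (≈-trans (u-stalls (≈⇒diff≈0 (≈-trans (≡⇒≈ (sym (snd-stepⁿ t (suc (double n)) v))) snd-period)))
                        (≡⇒≈ (sym (snd-stepⁿ t n v)))))
      where
        u-stalls : ∀ {w} → u t (suc (double n)) w - u t 0 w ≈ + 0 → u t (suc n) w ≈ u t n w
        u-stalls {w} h = [ (λ A≈0 → ⊥-elim (A≉0 A≈0)) , diff≈0⇒≈ ]′
          (x*y≈0⇒x≈0∨y≈0 prime (A½ t n) _ (≈-trans (≡⇒≈ (sym (A½-identity t n w))) h))

    module _ (2<m : 2 < m) where

      involution⇒± : ∀ t k v → stepⁿ t k (stepⁿ t k v) ≈² v → ∃[ s ] stepⁿ t k v ≈² s •² v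
      involution⇒± t k v@(v₁ , v₂) Sᵏw≈v with w@(w₁ , w₂) ← stepⁿ t k v in Sᵏv≡w =
        let s , w₁≈sv₁ , w₂≈sv₂ = same-products⇒± prime (≈-sym (fst≈ first-row)) (≈-sym (snd≈ second-row)) (snd≈ first-row)
        in s , (w₁≈sv₁ ,≈ w₂≈sv₂)
        where
          -- Sᵏ preserves det and swaps v and w, so det v w ≈ 0; moving scalings
          -- along Sᵏ then shows that v and w have the same coordinate products.
          open SetoidReasoning ≈-setoid
          det-antisymmetric : det v w ≈ - det v w
          det-antisymmetric = begin
            det v w                         ≡⟨ sym (det-stepⁿ t k v w) ⟩
            det (stepⁿ t k v) (stepⁿ t k w) ≡⟨ cong (λ x → det x (stepⁿ t k w)) Sᵏv≡w ⟩
            det w (stepⁿ t k w)             ≈⟨ minus-cong (*-cong (≈-refl {w₁}) (snd≈ Sᵏw≈v)) (*-cong (≈-refl {w₂}) (fst≈ Sᵏw≈v)) ⟩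
            det w v                         ≡⟨ antisym v₁ v₂ w₁ w₂ ⟩
            - det v w                       ∎
            where
              antisym : ∀ a b c d → c * b - d * a ≡ - (a * d - b * c)
              antisym = solve-∀
          cross : v₁ * w₂ ≈ v₂ * w₁
          cross = diff≈0⇒≈ (x≈-x⇒x≈0 prime 2<m det-antisymmetric)
          transfer : ∀ c d → scale c w ≈² scale d v → scale c v ≈² scale d w
          transfer c d h =
            ≈²-trans (scale-cong {c} (≈²-sym Sᵏw≈v))
              (≈²-trans (≡⇒≈² (sym (stepⁿ-scale t k c w)))
                (≈²-trans (stepⁿ-cong k (≈-refl {t}) h)
                  (≡⇒≈² (trans (stepⁿ-scale t k d v) (cong (scale d) Sᵏv≡w)))))
          first-row : scale v₁ v ≈² scale w₁ w
          first-row = transfer v₁ w₁ (≡⇒≈ (*-comm v₁ w₁) ,≈ ≈-trans cross (≡⇒≈ (*-comm v₂ w₁)))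
          second-row : scale v₂ v ≈² scale w₂ w
          second-row = transfer v₂ w₂ (≈-trans (≈-sym cross) (≡⇒≈ (*-comm v₁ w₂)) ,≈ ≡⇒≈ (*-comm v₂ w₂))

      A-half≈A½ : ∀ n β → A n (β * half m) ≈ A½ β n
      A-half≈A½ zero β = ≈-refl
      A-half≈A½ (suc zero) β = +-cong (twice-half prime 2<m β) ≈-refl
      A-half≈A½ (suc (suc k)) β = minus-cong (*-cong (twice-half prime 2<m β) (A-half≈A½ (suc k) β)) (A-half≈A½ k β)

      reflected-orbit⇒± : ∀ t k {v w} → stepⁿ t k w ≈² swap (step t v) →
        step t (swap w) ≈² swap (stepⁿ t k (swap v)) → ∃[ s ] w ≈² s •² swap v
      reflected-orbit⇒± t k {v} {w} Sᵏw≈ S[swap[w]]≈ =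
        let s , h = involution⇒± t (suc k) (swap v) involution in s , ≈²-trans w≈ h
        where
          w≈ : w ≈² stepⁿ t (suc k) (swap v)
          w≈ = ≈²-trans (≡⇒≈² (sym (step-swap-step t (swap w))))
                 (≈²-trans (step-cong (≈-refl {t}) (swap-cong S[swap[w]]≈))
                           (≡⇒≈² (sym (stepⁿ-suc t k (swap v)))))
          Sᵏ⁺¹w≈ : stepⁿ t (suc k) w ≈² swap v
          Sᵏ⁺¹w≈ = ≈²-trans (≡⇒≈² (stepⁿ-suc t k w))
                     (≈²-trans (step-cong (≈-refl {t}) Sᵏw≈) (≡⇒≈² (step-swap-step t v)))
          involution : stepⁿ t (suc k) (stepⁿ t (suc k) (swap v)) ≈² swap v
          involution = ≈²-trans (stepⁿ-cong (suc k) (≈-refl {t}) (≈²-sym w≈)) Sᵏ⁺¹w≈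

-- R₁ ∘ rotate, R₂ ∘ rotate and R₃ ∘ rotate are definitionally rotate ∘ R₂,
-- rotate ∘ R₃ and rotate ∘ R₁.
rotate : Triple → Triple
rotate (x , y , z) = (y , z , x)

iter-conj : ∀ {F G : Triple → Triple} (h : Triple → Triple) →
  (∀ T → F (h T) ≡ h (G T)) → ∀ n T → iter F n (h T) ≡ h (iter G n T)
iter-conj h F∘h≡h∘G zero T = refl
iter-conj {F} h F∘h≡h∘G (suc n) T = trans (cong F (iter-conj h F∘h≡h∘G n T)) (F∘h≡h∘G _)

in-plane₃ : ℤ → Pair → Triple
in-plane₃ z (x , y) = (x , y , z)

signed : ±.Sign → ±.Sign → Sign
signed ±.+ ±.+ = idσ
signed ±.+ ±.- = σ₁
signed ±.- ±.- = σ₂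
signed ±.- ±.+ = σ₃

act₃-signed : ∀ a b x y z → act₃ (signed a b) (x , y , z) ≡ (a • x , (a ±.* b) • y , b • z)
act₃-signed ±.+ ±.+ x y z = refl
act₃-signed ±.+ ±.- x y z = refl
act₃-signed ±.- ±.- x y z = refl
act₃-signed ±.- ±.+ x y z = refl

private
  triple≡ : ∀ {a b c a' b' c' : ℤ} → a ≡ a' → b ≡ b' → c ≡ c' → (a , b , c) ≡ (a' , b' , c')
  triple≡ refl refl refl = refl

  stepⁿ-suc-suc : ∀ t k v → stepⁿ t (suc (suc k)) v ≡ step t (step t (stepⁿ t k v))
  stepⁿ-suc-suc t k v = trans (stepⁿ-suc t (suc k) v) (cong (step t) (stepⁿ-suc t k v))

R₁-in-plane : ∀ z v → R₁ (in-plane₃ z v) ≡ in-plane₃ z (swap (step z v))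
R₁-in-plane z (x , y) = triple≡ (comm y z x) refl refl
  where
    comm : ∀ y z x → y * z - x ≡ z * y - x
    comm = solve-∀

iter-R₂R₁-in-plane : ∀ n z v → iter (R₂ ∘R R₁) n (in-plane₃ z v) ≡ in-plane₃ z (stepⁿ z (double n) v)
iter-R₂R₁-in-plane zero z v = refl
iter-R₂R₁-in-plane (suc n) z v =
  trans (cong (R₂ ∘R R₁) (iter-R₂R₁-in-plane n z v))
        (trans (one-round (stepⁿ z (double n) v)) (cong (in-plane₃ z) (sym (stepⁿ-suc-suc z (double n) v))))
  where
    one-round : ∀ w → (R₂ ∘R R₁) (in-plane₃ z w) ≡ in-plane₃ z (step z (step z w))
    one-round (x , y) = triple≡ (comm₁ x y z) (comm₂ x y z) refl
      where
        comm₁ : ∀ x y z → y * z - x ≡ z * y - x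
        comm₁ = solve-∀
        comm₂ : ∀ x y z → z * (y * z - x) - y ≡ z * (z * y - x) - y
        comm₂ = solve-∀

iter-R₁R₂-in-plane : ∀ n z v →
  iter (R₁ ∘R R₂) n (in-plane₃ z (swap v)) ≡ in-plane₃ z (swap (stepⁿ z (double n) v))
iter-R₁R₂-in-plane zero z v = refl
iter-R₁R₂-in-plane (suc n) z v =
  trans (cong (R₁ ∘R R₂) (iter-R₁R₂-in-plane n z v))
        (trans (one-round (stepⁿ z (double n) v)) (cong (in-plane₃ z ∘′ swap) (sym (stepⁿ-suc-suc z (double n) v))))
  where
    one-round : ∀ w → (R₁ ∘R R₂) (in-plane₃ z (swap w)) ≡ in-plane₃ z (swap (step z (step z w)))
    one-round (x , y) = triple≡ (comm x y z) refl refl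
      where
        comm : ∀ x y z → (z * y - x) * z - y ≡ z * (z * y - x) - y
        comm = solve-∀

Equivariant : Sign → (Triple → Triple) → Set
Equivariant σ F = ∀ T → F (act₃ σ T) ≡ act₃ σ (F T)

private
  even-signs : ∀ a b c → (- a) * (- b) - c ≡ a * b - c
  even-signs = solve-∀
  odd-signs : ∀ a b c → a * (- b) - (- c) ≡ - (a * b - c)
  odd-signs = solve-∀
  odd-signs′ : ∀ a b c → (- a) * b - (- c) ≡ - (a * b - c)
  odd-signs′ = solve-∀

R₁-equivariant : ∀ σ → Equivariant σ R₁
R₁-equivariant idσ T = refl
R₁-equivariant σ₁ (x , y , z) = triple≡ (even-signs y z x) refl refl
R₁-equivariant σ₂ (x , y , z) = triple≡ (odd-signs y z x) refl refl
R₁-equivariant σ₃ (x , y , z) = triple≡ (odd-signs′ y z x) refl refl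

R₂-equivariant : ∀ σ → Equivariant σ R₂
R₂-equivariant idσ T = refl
R₂-equivariant σ₁ (x , y , z) = triple≡ refl (odd-signs′ z x y) refl
R₂-equivariant σ₂ (x , y , z) = triple≡ refl (even-signs z x y) refl
R₂-equivariant σ₃ (x , y , z) = triple≡ refl (odd-signs z x y) refl

R₃-equivariant : ∀ σ → Equivariant σ R₃
R₃-equivariant idσ T = refl
R₃-equivariant σ₁ (x , y , z) = triple≡ refl refl (odd-signs x y z)
R₃-equivariant σ₂ (x , y , z) = triple≡ refl refl (odd-signs′ x y z)
R₃-equivariant σ₃ (x , y , z) = triple≡ refl refl (even-signs x y z)

∘-equivariant : ∀ {σ} F G → Equivariant σ F → Equivariant σ G → Equivariant σ (F ∘R G)
∘-equivariant F G F-eq G-eq T = trans (cong F (G-eq T)) (F-eq (G T))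

iter-equivariant : ∀ {σ F} → Equivariant σ F → ∀ n → Equivariant σ (iter F n)
iter-equivariant F-eq zero T = refl
iter-equivariant {F = F} F-eq (suc n) T = trans (cong F (iter-equivariant F-eq n T)) (F-eq (iter F n T))

act₃-involutive : ∀ σ T → act₃ σ (act₃ σ T) ≡ T
act₃-involutive idσ T = refl
act₃-involutive σ₁ (x , y , z) = triple≡ refl (•-cancel ±.- y) (•-cancel ±.- z)
act₃-involutive σ₂ (x , y , z) = triple≡ (•-cancel ±.- x) refl (•-cancel ±.- z)
act₃-involutive σ₃ (x , y , z) = triple≡ (•-cancel ±.- x) (•-cancel ±.- y) refl

act₃-third : ∀ σ T → ∃[ s ] proj₂ (proj₂ (act₃ σ T)) ≡ s • proj₂ (proj₂ T)
act₃-third idσ T = ±.+ , refl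
act₃-third σ₁ T = ±.- , refl
act₃-third σ₂ T = ±.- , refl
act₃-third σ₃ T = ±.+ , refl

iter-fixed : ∀ F {T} → F T ≡ T → ∀ n → iter F n T ≡ T
iter-fixed F F[T]≡T zero = refl
iter-fixed F F[T]≡T (suc n) = trans (cong F (iter-fixed F F[T]≡T n)) F[T]≡T

rotate₆ : Sextuple → Sextuple
rotate₆ (sext a b c d e f) = sext (rotate b) (rotate c) (rotate a) (rotate e) (rotate f) (rotate d)

module Configurations (m : ℕ) where

  open Congruence m

  record _≋_ (T T' : Triple) : Set where
    constructor tri
    field
      e₁ : proj₁ T ≈ proj₁ T'
      e₂ : proj₁ (proj₂ T) ≈ proj₁ (proj₂ T')
      e₃ : proj₂ (proj₂ T) ≈ proj₂ (proj₂ T')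
  open _≋_ public
  infix 4 _≋_

  ≈₃⇒≋ : ∀ {T T'} → T ≈₃[ m ] T' → T ≋ T'
  ≈₃⇒≋ (a , b , c) = tri (mk≈ a) (mk≈ b) (mk≈ c)

  ≋⇒≈₃ : ∀ {T T'} → T ≋ T' → T ≈₃[ m ] T'
  ≋⇒≈₃ (tri a b c) = un≈ a , un≈ b , un≈ c

  ≋-refl : ∀ {T} → T ≋ T
  ≋-refl = tri ≈-refl ≈-refl ≈-refl

  ≋-sym : ∀ {T T'} → T ≋ T' → T' ≋ T
  ≋-sym (tri a b c) = tri (≈-sym a) (≈-sym b) (≈-sym c)

  ≋-trans : ∀ {T T' T''} → T ≋ T' → T' ≋ T'' → T ≋ T''
  ≋-trans (tri a b c) (tri d e f) = tri (≈-trans a d) (≈-trans b e) (≈-trans c f)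

  ≡⇒≋ : ∀ {T T'} → T ≡ T' → T ≋ T'
  ≡⇒≋ refl = ≋-refl

  rotate-≋ : ∀ {T T'} → T ≋ T' → rotate T ≋ rotate T'
  rotate-≋ (tri a b c) = tri b c a

  unrotate-≋ : ∀ {T T'} → rotate T ≋ rotate T' → T ≋ T'
  unrotate-≋ h = rotate-≋ (rotate-≋ h)

  act₃-cong : ∀ σ {T T'} → T ≋ T' → act₃ σ T ≋ act₃ σ T'
  act₃-cong idσ h = h
  act₃-cong σ₁ (tri a b c) = tri a (-‿cong b) (-‿cong c)
  act₃-cong σ₂ (tri a b c) = tri (-‿cong a) b (-‿cong c)
  act₃-cong σ₃ (tri a b c) = tri (-‿cong a) (-‿cong b) c

  Congruent : (Triple → Triple) → Set
  Congruent F = ∀ {T T'} → T ≋ T' → F T ≋ F T'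

  R₁-cong : Congruent R₁
  R₁-cong (tri a b c) = tri (minus-cong (*-cong b c) a) b c

  R₂-cong : Congruent R₂
  R₂-cong (tri a b c) = tri a (minus-cong (*-cong c a) b) c

  R₃-cong : Congruent R₃
  R₃-cong (tri a b c) = tri a b (minus-cong (*-cong a b) c)

  iter-cong : ∀ {F} → Congruent F → ∀ n → Congruent (iter F n)
  iter-cong F-cong zero h = h
  iter-cong F-cong (suc n) h = F-cong (iter-cong F-cong n h)

  InM≈ : ℤ → Triple → Set
  InM≈ κ (x , y , z) = x * x + y * y + z * z ≈ x * y * z + κ

  InM-cong : ∀ {κ T T'} → T ≋ T' → InM≈ κ T → InM≈ κ T'
  InM-cong {κ} (tri a b c) h =
    ≈-trans (≈-sym (+-cong (+-cong (*-cong a a) (*-cong b b)) (*-cong c c)))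
      (≈-trans h (+-cong (*-cong (*-cong a b) c) (≈-refl {κ})))

  InM-rotate : ∀ {κ} T → InM≈ κ T → InM≈ κ (rotate T)
  InM-rotate {κ} (x , y , z) h =
    ≈-trans (≡⇒≈ (sum-rotate x y z)) (≈-trans h (≡⇒≈ (product-rotate x y z κ)))
    where
      sum-rotate : ∀ x y z → y * y + z * z + x * x ≡ x * x + y * y + z * z
      sum-rotate = solve-∀
      product-rotate : ∀ x y z k → x * y * z + k ≡ y * z * x + k
      product-rotate = solve-∀

  InM-act : ∀ {κ} σ T → InM≈ κ T → InM≈ κ (act₃ σ T)
  InM-act idσ T h = h
  InM-act {κ} σ₁ (x , y , z) h = ≈-trans (≡⇒≈ (sum₁ x y z)) (≈-trans h (≡⇒≈ (product₁ x y z κ)))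
    where
      sum₁ : ∀ x y z → x * x + (- y) * (- y) + (- z) * (- z) ≡ x * x + y * y + z * z
      sum₁ = solve-∀
      product₁ : ∀ x y z k → x * y * z + k ≡ x * (- y) * (- z) + k
      product₁ = solve-∀
  InM-act {κ} σ₂ (x , y , z) h = ≈-trans (≡⇒≈ (sum₂ x y z)) (≈-trans h (≡⇒≈ (product₂ x y z κ)))
    where
      sum₂ : ∀ x y z → (- x) * (- x) + y * y + (- z) * (- z) ≡ x * x + y * y + z * z
      sum₂ = solve-∀
      product₂ : ∀ x y z k → x * y * z + k ≡ (- x) * y * (- z) + k
      product₂ = solve-∀
  InM-act {κ} σ₃ (x , y , z) h = ≈-trans (≡⇒≈ (sum₃ x y z)) (≈-trans h (≡⇒≈ (product₃ x y z κ)))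
    where
      sum₃ : ∀ x y z → (- x) * (- x) + (- y) * (- y) + z * z ≡ x * x + y * y + z * z
      sum₃ = solve-∀
      product₃ : ∀ x y z k → x * y * z + k ≡ (- x) * (- y) * z + k
      product₃ = solve-∀

  record _≋₆_ (s t : Sextuple) : Set where
    constructor six
    field
      X₁≋ : X₁ s ≋ X₁ t
      X₂≋ : X₂ s ≋ X₂ t
      X₃≋ : X₃ s ≋ X₃ t
      Y₁≋ : Y₁ s ≋ Y₁ t
      Y₂≋ : Y₂ s ≋ Y₂ t
      Y₃≋ : Y₃ s ≋ Y₃ t
  open _≋₆_ public
  infix 4 _≋₆_

  ≈₆⇒≋₆ : ∀ {s t} → s ≈₆[ m ] t → s ≋₆ t
  ≈₆⇒≋₆ (a , b , c , d , e , f) = six (≈₃⇒≋ a) (≈₃⇒≋ b) (≈₃⇒≋ c) (≈₃⇒≋ d) (≈₃⇒≋ e) (≈₃⇒≋ f)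

  ≋₆⇒≈₆ : ∀ {s t} → s ≋₆ t → s ≈₆[ m ] t
  ≋₆⇒≈₆ (six a b c d e f) = ≋⇒≈₃ a , ≋⇒≈₃ b , ≋⇒≈₃ c , ≋⇒≈₃ d , ≋⇒≈₃ e , ≋⇒≈₃ f

  ≋₆-sym : ∀ {s t} → s ≋₆ t → t ≋₆ s
  ≋₆-sym (six a b c d e f) = six (≋-sym a) (≋-sym b) (≋-sym c) (≋-sym d) (≋-sym e) (≋-sym f)

  ≋₆-trans : ∀ {s t r} → s ≋₆ t → t ≋₆ r → s ≋₆ r
  ≋₆-trans (six a b c d e f) (six a' b' c' d' e' f') =
    six (≋-trans a a') (≋-trans b b') (≋-trans c c') (≋-trans d d') (≋-trans e e') (≋-trans f f')

  rotate₆-≋₆ : ∀ {s t} → s ≋₆ t → rotate₆ s ≋₆ rotate₆ t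
  rotate₆-≋₆ (six a b c d e f) =
    six (rotate-≋ b) (rotate-≋ c) (rotate-≋ a) (rotate-≋ e) (rotate-≋ f) (rotate-≋ d)

  act-cong : ∀ σ {s t} → s ≋₆ t → act σ s ≋₆ act σ t
  act-cong σ (six a b c d e f) =
    six (act₃-cong σ a) (act₃-cong σ b) (act₃-cong σ c) (act₃-cong σ d) (act₃-cong σ e) (act₃-cong σ f)

  act-involutive : ∀ σ s → act σ (act σ s) ≋₆ s
  act-involutive σ s = six (inv (X₁ s)) (inv (X₂ s)) (inv (X₃ s)) (inv (Y₁ s)) (inv (Y₂ s)) (inv (Y₃ s))
    where
      inv : ∀ T → act₃ σ (act₃ σ T) ≋ T
      inv T = ≡⇒≋ (act₃-involutive σ T)

  ≋₆-refl : ∀ {s} → s ≋₆ s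
  ≋₆-refl = six ≋-refl ≋-refl ≋-refl ≋-refl ≋-refl ≋-refl

  act-O : ∀ σ → act σ (const6 O) ≋₆ const6 O
  act-O idσ = ≋₆-refl
  act-O σ₁ = ≋₆-refl
  act-O σ₂ = ≋₆-refl
  act-O σ₃ = ≋₆-refl

  -- Rotating coordinates permutes the fifteen conditions of Kall in five
  -- orbits of length three; Kall₁ keeps one condition from each orbit.
  record Kall₁ (n : ℕ) (κ : ℤ) (s : Sextuple) : Set where
    field
      X₁∈M : InM≈ κ (X₁ s)
      Y₁∈M : InM≈ κ (Y₁ s)
      Y₁≋R₁X₁ : Y₁ s ≋ R₁ (X₁ s)
      Y₁≋[R₂R₁]ⁿX₂ : Y₁ s ≋ iter (R₂ ∘R R₁) n (X₂ s)
      Y₁≋[R₃R₁]ⁿX₃ : Y₁ s ≋ iter (R₃ ∘R R₁) n (X₃ s)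
  open Kall₁ public

  Kall≋ : ℕ → ℤ → Sextuple → Set
  Kall≋ n κ s = Kall₁ n κ s × Kall₁ n κ (rotate₆ s) × Kall₁ n κ (rotate₆ (rotate₆ s))

  Kall≋-rotate : ∀ {n κ s} → Kall≋ n κ s → Kall≋ n κ (rotate₆ s)
  Kall≋-rotate (k , k′ , k″) = k′ , k″ , k

  Kall₁-resp : ∀ {n κ s t} → s ≋₆ t → Kall₁ n κ s → Kall₁ n κ t
  Kall₁-resp {n} (six a b c d e f) k = record
    { X₁∈M = InM-cong a (X₁∈M k)
    ; Y₁∈M = InM-cong d (Y₁∈M k)
    ; Y₁≋R₁X₁ = along R₁-cong a (Y₁≋R₁X₁ k)
    ; Y₁≋[R₂R₁]ⁿX₂ = along (iter-cong (R₂-cong ∘′ R₁-cong) n) b (Y₁≋[R₂R₁]ⁿX₂ k)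
    ; Y₁≋[R₃R₁]ⁿX₃ = along (iter-cong (R₃-cong ∘′ R₁-cong) n) c (Y₁≋[R₃R₁]ⁿX₃ k)
    }
    where
      along : ∀ {F X X'} → Congruent F → X ≋ X' → _ ≋ F X → _ ≋ F X'
      along F-cong X≋X' h = ≋-trans (≋-sym d) (≋-trans h (F-cong X≋X'))

  Kall₁-act : ∀ {n κ} σ {s} → Kall₁ n κ s → Kall₁ n κ (act σ s)
  Kall₁-act {n} σ {s} k = record
    { X₁∈M = InM-act σ (X₁ s) (X₁∈M k)
    ; Y₁∈M = InM-act σ (Y₁ s) (Y₁∈M k)
    ; Y₁≋R₁X₁ = moved (R₁-equivariant σ) (Y₁≋R₁X₁ k)
    ; Y₁≋[R₂R₁]ⁿX₂ = moved (iter-equivariant (∘-equivariant R₂ R₁ (R₂-equivariant σ) (R₁-equivariant σ)) n) (Y₁≋[R₂R₁]ⁿX₂ k)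
    ; Y₁≋[R₃R₁]ⁿX₃ = moved (iter-equivariant (∘-equivariant R₃ R₁ (R₃-equivariant σ) (R₁-equivariant σ)) n) (Y₁≋[R₃R₁]ⁿX₃ k)
    }
    where
      moved : ∀ {F X} → Equivariant σ F → Y₁ s ≋ F X → act₃ σ (Y₁ s) ≋ F (act₃ σ X)
      moved {X = X} F-eq h = ≋-trans (act₃-cong σ h) (≡⇒≋ (sym (F-eq X)))

  Kall≋-resp : ∀ {n κ s t} → s ≋₆ t → Kall≋ n κ s → Kall≋ n κ t
  Kall≋-resp s≋t (k , k′ , k″) =
    Kall₁-resp s≋t k , Kall₁-resp (rotate₆-≋₆ s≋t) k′ , Kall₁-resp (rotate₆-≋₆ (rotate₆-≋₆ s≋t)) k″

  -- Rotating coordinates conjugates σ₁ to σ₃, σ₃ to σ₂ and σ₂ to σ₁.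
  Kall≋-act : ∀ {n κ} σ {s} → Kall≋ n κ s → Kall≋ n κ (act σ s)
  Kall≋-act idσ k = k
  Kall≋-act σ₁ (k , k′ , k″) = Kall₁-act σ₁ k , Kall₁-act σ₃ k′ , Kall₁-act σ₂ k″
  Kall≋-act σ₂ (k , k′ , k″) = Kall₁-act σ₂ k , Kall₁-act σ₁ k′ , Kall₁-act σ₃ k″
  Kall≋-act σ₃ (k , k′ , k″) = Kall₁-act σ₃ k , Kall₁-act σ₂ k′ , Kall₁-act σ₁ k″

  private
    rotated : ∀ {Y Z W} → W ≡ rotate Z → Y ≋ Z → rotate Y ≋ W
    rotated W≡ h = ≋-trans (rotate-≋ h) (≡⇒≋ (sym W≡))

    unrotated : ∀ {Y Z W} → W ≡ rotate Z → rotate Y ≋ W → Y ≋ Z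
    unrotated W≡ h = unrotate-≋ (≋-trans h (≡⇒≋ W≡))

    rotate² : Triple → Triple
    rotate² T = rotate (rotate T)

  Kall⇒Kall≋ : ∀ {n κ s} → Kall m n κ s → Kall≋ n κ s
  Kall⇒Kall≋ {n} {κ} {s} (m₁ , m₂ , m₃ , m₄ , m₅ , m₆ , r₁ , r₂ , r₃ , r₄ , r₅ , r₆ , r₇ , r₈ , r₉) =
    record
      { X₁∈M = mk≈ m₁ ; Y₁∈M = mk≈ m₄ ; Y₁≋R₁X₁ = ≈₃⇒≋ r₁
      ; Y₁≋[R₂R₁]ⁿX₂ = ≈₃⇒≋ r₂ ; Y₁≋[R₃R₁]ⁿX₃ = ≈₃⇒≋ r₃ } ,
    record
      { X₁∈M = InM-rotate (X₂ s) (mk≈ m₂) ; Y₁∈M = InM-rotate (Y₂ s) (mk≈ m₅)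
      ; Y₁≋R₁X₁ = rotate-≋ (≈₃⇒≋ r₄)
      ; Y₁≋[R₂R₁]ⁿX₂ = rotated (iter-conj rotate (λ _ → refl) n (X₃ s)) (≈₃⇒≋ r₅)
      ; Y₁≋[R₃R₁]ⁿX₃ = rotated (iter-conj rotate (λ _ → refl) n (X₁ s)) (≈₃⇒≋ r₆) } ,
    record
      { X₁∈M = InM-rotate (rotate (X₃ s)) (InM-rotate (X₃ s) (mk≈ m₃))
      ; Y₁∈M = InM-rotate (rotate (Y₃ s)) (InM-rotate (Y₃ s) (mk≈ m₆))
      ; Y₁≋R₁X₁ = rotate-≋ (rotate-≋ (≈₃⇒≋ r₇))
      ; Y₁≋[R₂R₁]ⁿX₂ = rotated (iter-conj rotate² (λ _ → refl) n (X₁ s)) (rotate-≋ (≈₃⇒≋ r₈))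
      ; Y₁≋[R₃R₁]ⁿX₃ = rotated (iter-conj rotate² (λ _ → refl) n (X₂ s)) (rotate-≋ (≈₃⇒≋ r₉)) }

  Y₂≋R₂X₂ : ∀ {n κ s} → Kall≋ n κ s → Y₂ s ≋ R₂ (X₂ s)
  Y₂≋R₂X₂ (_ , k′ , _) = unrotate-≋ (Y₁≋R₁X₁ k′)

  Y₂≋[R₁R₂]ⁿX₁ : ∀ {n κ s} → Kall≋ n κ s → Y₂ s ≋ iter (R₁ ∘R R₂) n (X₁ s)
  Y₂≋[R₁R₂]ⁿX₁ {n} {s = s} (_ , k′ , _) = unrotated (iter-conj rotate (λ _ → refl) n (X₁ s)) (Y₁≋[R₃R₁]ⁿX₃ k′)

  Y₃≋R₃X₃ : ∀ {n κ s} → Kall≋ n κ s → Y₃ s ≋ R₃ (X₃ s)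
  Y₃≋R₃X₃ (_ , _ , k″) = rotate-≋ (Y₁≋R₁X₁ k″)

  Kall≋⇒Kall : ∀ {n κ s} → Kall≋ n κ s → Kall m n κ s
  Kall≋⇒Kall {n} {κ} {s} k≋@(k , k′ , k″) =
    un≈ (X₁∈M k) ,
    un≈ (InM-rotate (rotate² (X₂ s)) (InM-rotate (rotate (X₂ s)) (X₁∈M k′))) ,
    un≈ (InM-rotate (rotate² (X₃ s)) (X₁∈M k″)) ,
    un≈ (Y₁∈M k) ,
    un≈ (InM-rotate (rotate² (Y₂ s)) (InM-rotate (rotate (Y₂ s)) (Y₁∈M k′))) ,
    un≈ (InM-rotate (rotate² (Y₃ s)) (Y₁∈M k″)) ,
    ≋⇒≈₃ (Y₁≋R₁X₁ k) ,
    ≋⇒≈₃ (Y₁≋[R₂R₁]ⁿX₂ k) ,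
    ≋⇒≈₃ (Y₁≋[R₃R₁]ⁿX₃ k) ,
    ≋⇒≈₃ (Y₂≋R₂X₂ k≋) ,
    ≋⇒≈₃ (unrotated (iter-conj rotate (λ _ → refl) n (X₃ s)) (Y₁≋[R₂R₁]ⁿX₂ k′)) ,
    ≋⇒≈₃ (Y₂≋[R₁R₂]ⁿX₁ k≋) ,
    ≋⇒≈₃ (Y₃≋R₃X₃ k≋) ,
    ≋⇒≈₃ (rotate-≋ (≋-trans (Y₁≋[R₂R₁]ⁿX₂ k″) (≡⇒≋ (iter-conj rotate² (λ _ → refl) n (X₁ s))))) ,
    ≋⇒≈₃ (rotate-≋ (≋-trans (Y₁≋[R₃R₁]ⁿX₃ k″) (≡⇒≋ (iter-conj rotate² (λ _ → refl) n (X₂ s)))))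


module Classification (p : ℕ) (prime : Prime p) (2<p : 2 < p) where

  open Congruence p
  open RecurrenceModulo p
  open Configurations p

  private
    in-plane-≋ : ∀ {t t' v w} → in-plane₃ t v ≋ in-plane₃ t' w → v ≈² w
    in-plane-≋ (tri a b _) = a ,≈ b

  SignedSwap : Triple → Triple → Set
  SignedSwap (x , y , z) (x' , y' , z') = z' ≈ z × ∃[ s ] (x' , y') ≈² s •² (y , x)

  Kall≋⇒signed-swap : ∀ {n κ s} → Kall≋ n κ s → SignedSwap (X₁ s) (X₂ s)
  Kall≋⇒signed-swap {n} {s = s} k≋@(k , _ , _) =
    z₂≈z₁ , reflected-orbit⇒± prime 2<p z₁ (double n) Sᵏw≈ Sswapw≈
    where
      z₁ = proj₂ (proj₂ (X₁ s))
      z₂ = proj₂ (proj₂ (X₂ s))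
      v = (proj₁ (X₁ s) , proj₁ (proj₂ (X₁ s)))
      w = (proj₁ (X₂ s) , proj₁ (proj₂ (X₂ s)))
      Y₁-via-X₁ : Y₁ s ≋ in-plane₃ z₁ (swap (step z₁ v))
      Y₁-via-X₁ = ≋-trans (Y₁≋R₁X₁ k) (≡⇒≋ (R₁-in-plane z₁ v))
      Y₁-via-X₂ : Y₁ s ≋ in-plane₃ z₂ (stepⁿ z₂ (double n) w)
      Y₁-via-X₂ = ≋-trans (Y₁≋[R₂R₁]ⁿX₂ k) (≡⇒≋ (iter-R₂R₁-in-plane n z₂ w))
      Y₂-via-X₁ : Y₂ s ≋ in-plane₃ z₁ (swap (stepⁿ z₁ (double n) (swap v)))
      Y₂-via-X₁ = ≋-trans (Y₂≋[R₁R₂]ⁿX₁ k≋) (≡⇒≋ (iter-R₁R₂-in-plane n z₁ (swap v)))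
      z₂≈z₁ : z₂ ≈ z₁
      z₂≈z₁ = ≈-trans (≈-sym (e₃ Y₁-via-X₂)) (e₃ Y₁-via-X₁)
      Sᵏw≈ : stepⁿ z₁ (double n) w ≈² swap (step z₁ v)
      Sᵏw≈ = ≈²-trans (stepⁿ-cong (double n) (≈-sym z₂≈z₁) ≈²-refl)
                      (in-plane-≋ (≋-trans (≋-sym Y₁-via-X₂) Y₁-via-X₁))
      Sswapw≈ : step z₁ (swap w) ≈² swap (stepⁿ z₁ (double n) (swap v))
      Sswapw≈ = ≈²-trans (step-cong (≈-sym z₂≈z₁) ≈²-refl)
                         (in-plane-≋ (≋-trans (≋-sym (Y₂≋R₂X₂ k≋)) Y₂-via-X₁))

  NormalForm : Triple → Triple → Triple → Set
  NormalForm X₁ X₂ X₃ = ∃[ σ ] ∃[ α ] ∃[ β ]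
    X₁ ≋ act₃ σ (α , β , β) × X₂ ≋ act₃ σ (β , α , β) × X₃ ≋ act₃ σ (β , β , α)

  -- Only the fixed coordinate of the signed swap from X₃ to X₁ is needed.
  signed-swaps⇒normal-form : ∀ {X₁ X₂ X₃} → SignedSwap X₁ X₂ → SignedSwap (rotate X₂) (rotate X₃) →
    proj₁ (proj₂ X₁) ≈ proj₁ (proj₂ X₃) → NormalForm X₁ X₂ X₃
  signed-swaps⇒normal-form {x₁ , y₁ , z₁} {x₂ , y₂ , z₂} {x₃ , y₃ , z₃}
    (z₂≈z₁ , e , (x₂≈ey₁ ,≈ y₂≈ex₁)) (x₃≈x₂ , f , (y₃≈fz₂ ,≈ z₃≈fy₂)) y₁≈y₃ =
    signed f e , f • x₁ , e • z₁ , X₁-form , X₂-form , X₃-form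
    where
      as-signed : ∀ {x y z a b c} → x ≈ f • a → y ≈ (f ±.* e) • b → z ≈ e • c →
        (x , y , z) ≋ act₃ (signed f e) (a , b , c)
      as-signed {a = a} {b} {c} hx hy hz = ≋-trans (tri hx hy hz) (≡⇒≋ (sym (act₃-signed f e a b c)))
      y₁≈fz₁ : y₁ ≈ f • z₁
      y₁≈fz₁ = ≈-trans y₁≈y₃ (≈-trans y₃≈fz₂ (•-cong f z₂≈z₁))
      x₂≈ : x₂ ≈ f • (e • z₁)
      x₂≈ = ≈-trans x₂≈ey₁ (≈-trans (•-cong e y₁≈fz₁) (≡⇒≈ (•-comm e f z₁)))
      z≈ : z₁ ≈ e • (e • z₁)
      z≈ = ≈-sym (≡⇒≈ (•-cancel e z₁))
      X₁-form : (x₁ , y₁ , z₁) ≋ act₃ (signed f e) (f • x₁ , e • z₁ , e • z₁)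
      X₁-form = as-signed (≈-sym (≡⇒≈ (•-cancel f x₁))) (≈-trans y₁≈fz₁ (≡⇒≈ (sym (•-absorb f e z₁)))) z≈
      X₂-form : (x₂ , y₂ , z₂) ≋ act₃ (signed f e) (e • z₁ , f • x₁ , e • z₁)
      X₂-form = as-signed x₂≈
        (≈-trans y₂≈ex₁ (≡⇒≈ (sym (trans (cong (_• (f • x₁)) (±ₚ.*-comm f e)) (•-absorb e f x₁)))))
        (≈-trans z₂≈z₁ z≈)
      X₃-form : (x₃ , y₃ , z₃) ≋ act₃ (signed f e) (e • z₁ , e • z₁ , f • x₁)
      X₃-form = as-signed (≈-trans x₃≈x₂ x₂≈)
        (≈-trans (≈-trans y₃≈fz₂ (•-cong f z₂≈z₁)) (≡⇒≈ (sym (•-absorb f e z₁))))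
        (≈-trans z₃≈fy₂ (≈-trans (•-cong f y₂≈ex₁) (≡⇒≈ (•-comm f e x₁))))

  private
    1<p : 1 < p
    1<p = ℕₚ.<-trans (ℕₚ.n<1+n 1) 2<p

    A½≉0-at-zero : ∀ n {β} → β ≈ + 0 → ¬ (A½ β n ≈ + 0)
    A½≉0-at-zero n β≈0 A≈0 =
      let s , A≡ = A½-at-zero n
      in ±1≉0 1<p s (≈-trans (≡⇒≈ (sym A≡)) (≈-trans (A½-cong n (≈-sym β≈0)) A≈0))

    K-X₁-defect : ∀ κ α β → (α * α + β * β + β * β) - (α * β * β + κ) ≡ α * α - β * β * α + + 2 * β * β - κ
    K-X₁-defect = solve-∀

    K-Y₁-defect : ∀ κ α β →
      ((β * β - α) * (β * β - α) + β * β + β * β) - ((β * β - α) * β * β + κ) ≡ α * α - β * β * α + + 2 * β * β - κ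
    K-Y₁-defect = solve-∀

  K-half-orbit : ∀ {n κ α β} → Kall₁ n κ (K α β) → stepⁿ β (double n) (β , α) ≈² (β * β - α , β)
  K-half-orbit {n} {α = α} {β} k =
    ≈²-sym (in-plane-≋ (≋-trans (Y₁≋[R₂R₁]ⁿX₂ k) (≡⇒≋ (iter-R₂R₁-in-plane n β (β , α)))))

  K-in-Kall : ∀ {n κ α β} → A½ β n ≈ + 0 → f κ β α ≈ + 0 → Kall≋ n κ (K α β)
  K-in-Kall {n} {κ} {α} {β} A≈0 f≈0 = k , k , k
    where
      ᾱ = β * β - α
      half-orbit : stepⁿ β (double n) (β , α) ≈² (ᾱ , β)
      half-orbit = ≈²-trans (stepⁿ-cong (double n) (≈-refl {β}) (≈-refl ,≈ ≡⇒≈ (other-root α β)))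
                            (A½≈0⇒period β n (ᾱ , β) A≈0)
        where
          other-root : ∀ α β → α ≡ β * β - (β * β - α)
          other-root = solve-∀
      k : Kall₁ n κ (K α β)
      k = record
        { X₁∈M = diff≈0⇒≈ (≈-trans (≡⇒≈ (K-X₁-defect κ α β)) f≈0)
        ; Y₁∈M = diff≈0⇒≈ (≈-trans (≡⇒≈ (K-Y₁-defect κ α β)) f≈0)
        ; Y₁≋R₁X₁ = ≋-refl
        ; Y₁≋[R₂R₁]ⁿX₂ = ≋-trans (tri (≈-sym (fst≈ half-orbit)) (≈-sym (snd≈ half-orbit)) ≈-refl)
                                 (≡⇒≋ (sym (iter-R₂R₁-in-plane n β (β , α))))
        ; Y₁≋[R₃R₁]ⁿX₃ = ≋-trans (tri (≈-sym (fst≈ half-orbit)) ≈-refl (≈-sym (snd≈ half-orbit)))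
                                 (≡⇒≋ (sym (trans (iter-conj rotate (λ _ → refl) n (α , β , β))
                                                  (cong rotate (iter-R₁R₂-in-plane n β (β , α))))))
        }

  ExceptionalK : ℕ → ℤ → Sextuple → Set
  ExceptionalK n κ t =
    (κ ≈ + 0 × t ≋₆ const6 O) ⊎ (κ ≈ + 4 × ¬ (+ (2 ℕ.* n ℕ.+ 1) ≈ + 0) × t ≋₆ const6 P)

  private
    K≋const6 : ∀ {α β c} → α ≈ c → β ≈ c → c * c - c ≡ c → K α β ≋₆ const6 (c , c , c)
    K≋const6 α≈c β≈c c²-c≡c = six (tri α≈c β≈c β≈c) (tri β≈c α≈c β≈c) (tri β≈c β≈c α≈c)
      (tri ᾱ≈c β≈c β≈c) (tri β≈c ᾱ≈c β≈c) (tri β≈c β≈c ᾱ≈c)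
      where
        ᾱ≈c = ≈-trans (minus-cong (*-cong β≈c β≈c) α≈c) (≡⇒≈ c²-c≡c)

  K-analysis : ∀ {n κ α β} → Kall≋ n κ (K α β) → Tall p n κ α β ⊎ ExceptionalK n κ (K α β)
  K-analysis {n} {κ} {α} {β} (k , _ , _) with A½ β n ≈0?
  ... | yes A≈0 = inj₁ ((λ β≈0 → A½≉0-at-zero n (mk≈ β≈0) A≈0) ,
                        un≈ (≈-trans (A-half≈A½ prime 2<p n β) A≈0) , un≈ f≈0)
    where
      f≈0 : f κ β α ≈ + 0
      f≈0 = ≈-trans (≡⇒≈ (sym (K-X₁-defect κ α β))) (≈⇒diff≈0 (X₁∈M k))
  ... | no A≉0 = inj₂ (exceptional (x*y≈0⇒x≈0∨y≈0 prime β (β - + 2) β[β-2]≈0))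
    where
      fixed : step β (β , α) ≈² (β , α)
      fixed = period⇒fixed prime β n (β , α) A≉0
        (≈²-trans (≡⇒≈² (stepⁿ-suc β (double n) (β , α)))
          (≈²-trans (step-cong (≈-refl {β}) (K-half-orbit k)) (≈-refl ,≈ ≡⇒≈ (other-root α β))))
        where
          other-root : ∀ α β → β * β - (β * β - α) ≡ α
          other-root = solve-∀
      α≈β : α ≈ β
      α≈β = fst≈ fixed
      β[β-2]≈0 : β * (β - + 2) ≈ + 0
      β[β-2]≈0 = ≈-trans (≡⇒≈ (expand β))
        (≈-trans (minus-cong (minus-cong (*-cong (≈-refl {β}) (≈-sym α≈β)) (≈-refl {β})) (≈-sym α≈β))
          (≈⇒diff≈0 (snd≈ fixed)))
        where
          expand : ∀ β → β * (β - + 2) ≡ (β * β - β) - β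
          expand = solve-∀
      M-at : ∀ {c} → α ≈ c → β ≈ c → c * c + c * c + c * c ≈ c * c * c + κ
      M-at α≈c β≈c = InM-cong (tri α≈c β≈c β≈c) (X₁∈M k)
      exceptional : β ≈ + 0 ⊎ β - + 2 ≈ + 0 → ExceptionalK n κ (K α β)
      exceptional (inj₁ β≈0) = inj₁ (κ≈0 , K≋const6 α≈0 β≈0 refl)
        where
          α≈0 = ≈-trans α≈β β≈0
          κ≈0 : κ ≈ + 0
          κ≈0 = ≈-sym (≈-trans (M-at α≈0 β≈0) (≡⇒≈ (zero-plus κ)))
            where
              zero-plus : ∀ k → + 0 + k ≡ k
              zero-plus = solve-∀
      exceptional (inj₂ β-2≈0) = inj₂ (κ≈4 , 2n+1≉0 , K≋const6 α≈2 β≈2 refl)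
        where
          β≈2 = diff≈0⇒≈ β-2≈0
          α≈2 = ≈-trans α≈β β≈2
          κ≈4 : κ ≈ + 4
          κ≈4 = ≈-trans (≡⇒≈ (shift κ)) (minus-cong (≈-sym (M-at α≈2 β≈2)) (≈-refl {+ 8}))
            where
              shift : ∀ k → k ≡ (+ 8 + k) - + 8
              shift = solve-∀
          2n+1≉0 : ¬ (+ (2 ℕ.* n ℕ.+ 1) ≈ + 0)
          2n+1≉0 h = A≉0 (≈-trans (A½-cong n β≈2) (≈-trans (≡⇒≈ (A½-at-two n)) h))

  fixed-point-Kall₁ : ∀ {n κ} T → InM≈ κ T → R₁ T ≡ T → R₂ T ≡ T → R₃ T ≡ T → Kall₁ n κ (const6 T)
  fixed-point-Kall₁ {n} T T∈M R₁T≡T R₂T≡T R₃T≡T = record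
    { X₁∈M = T∈M
    ; Y₁∈M = T∈M
    ; Y₁≋R₁X₁ = ≡⇒≋ (sym R₁T≡T)
    ; Y₁≋[R₂R₁]ⁿX₂ = ≡⇒≋ (sym (iter-fixed (R₂ ∘R R₁) (trans (cong R₂ R₁T≡T) R₂T≡T) n))
    ; Y₁≋[R₃R₁]ⁿX₃ = ≡⇒≋ (sym (iter-fixed (R₃ ∘R R₁) (trans (cong R₃ R₁T≡T) R₃T≡T) n))
    }

  Kall≋⇒normal-form : ∀ {n κ s} → Kall≋ n κ s → NormalForm (X₁ s) (X₂ s) (X₃ s)
  Kall≋⇒normal-form k =
    signed-swaps⇒normal-form (Kall≋⇒signed-swap k) (Kall≋⇒signed-swap (Kall≋-rotate k))
      (proj₁ (Kall≋⇒signed-swap (Kall≋-rotate (Kall≋-rotate k))))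

  normal-form⇒≋K : ∀ {n κ s σ α β} → Kall≋ n κ s → X₁ s ≋ act₃ σ (α , β , β) →
    X₂ s ≋ act₃ σ (β , α , β) → X₃ s ≋ act₃ σ (β , β , α) → s ≋₆ act σ (K α β)
  normal-form⇒≋K {σ = σ} {α} {β} k X₁-form X₂-form X₃-form = six X₁-form X₂-form X₃-form
    (reflect R₁-cong (R₁-equivariant σ (α , β , β)) (Y₁≋R₁X₁ (proj₁ k)) X₁-form)
    (reflect R₂-cong (R₂-equivariant σ (β , α , β)) (Y₂≋R₂X₂ k) X₂-form)
    (reflect R₃-cong (R₃-equivariant σ (β , β , α)) (Y₃≋R₃X₃ k) X₃-form)
    where
      reflect : ∀ {F Y X T} → Congruent F → F (act₃ σ T) ≡ act₃ σ (F T) →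
        Y ≋ F X → X ≋ act₃ σ T → Y ≋ act₃ σ (F T)
      reflect F-cong F-eq Y≋ X≋ = ≋-trans Y≋ (≋-trans (F-cong X≋) (≡⇒≋ F-eq))

  exceptional⇒InE : ∀ {n κ s σ t} → s ≋₆ act σ t → ExceptionalK n κ t → InE p n κ s
  exceptional⇒InE {σ = σ} s≋ (inj₁ (κ≈0 , t≋O)) =
    inj₁ (un≈ κ≈0 , ≋₆⇒≈₆ (≋₆-trans s≋ (≋₆-trans (act-cong σ t≋O) (act-O σ))))
  exceptional⇒InE {σ = σ} s≋ (inj₂ (κ≈4 , 2n+1≉0 , t≋P)) =
    inj₂ (un≈ κ≈4 , (λ h → 2n+1≉0 (mk≈ h)) , σ , ≋₆⇒≈₆ (≋₆-trans s≋ (act-cong σ t≋P)))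

  Kall⇒orbit⊎E : ∀ {n κ s} → Kall p n κ s → InOrbitSet p (Tall p n κ) s ⊎ InE p n κ s
  Kall⇒orbit⊎E {n} {κ} {s} k = classify (Kall≋⇒normal-form k≋)
    where
      k≋ : Kall≋ n κ s
      k≋ = Kall⇒Kall≋ k
      classify : NormalForm (X₁ s) (X₂ s) (X₃ s) → InOrbitSet p (Tall p n κ) s ⊎ InE p n κ s
      classify (σ , α , β , X₁-form , X₂-form , X₃-form) =
        Sum.map (λ t → α , β , σ , t , ≋₆⇒≈₆ s≋) (exceptional⇒InE {n} s≋) (K-analysis K∈Kall)
        where
          s≋ : s ≋₆ act σ (K α β)
          s≋ = normal-form⇒≋K k≋ X₁-form X₂-form X₃-form
          K∈Kall : Kall≋ n κ (K α β)
          K∈Kall = Kall≋-resp (act-involutive σ (K α β)) (Kall≋-act σ (Kall≋-resp s≋ k≋))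

  orbit⊎E⇒Kall : ∀ {n κ s} → InOrbitSet p (Tall p n κ) s ⊎ InE p n κ s → Kall p n κ s
  orbit⊎E⇒Kall {n} {κ} {s} (inj₁ (α , β , σ , (_ , A≈0 , f≈0) , s≈)) =
    Kall≋⇒Kall {n} (Kall≋-resp (≋₆-sym (≈₆⇒≋₆ {s} {act σ (K α β)} s≈)) (Kall≋-act σ (K-in-Kall A½≈0 (mk≈ f≈0))))
    where
      A½≈0 : A½ β n ≈ + 0
      A½≈0 = ≈-trans (≈-sym (A-half≈A½ prime 2<p n β)) (mk≈ A≈0)
  orbit⊎E⇒Kall {n} {κ} {s} (inj₂ (inj₁ (κ≈0 , s≈))) =
    Kall≋⇒Kall {n} (Kall≋-resp (≋₆-sym (≈₆⇒≋₆ {s} {const6 O} s≈)) (k , k , k))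
    where
      k : Kall₁ n κ (const6 O)
      k = fixed-point-Kall₁ O (≈-trans (≈-sym (mk≈ κ≈0)) (≡⇒≈ (sym (zero-plus κ)))) refl refl refl
        where
          zero-plus : ∀ k → + 0 + k ≡ k
          zero-plus = solve-∀
  orbit⊎E⇒Kall {n} {κ} {s} (inj₂ (inj₂ (κ≈4 , _ , σ , s≈))) =
    Kall≋⇒Kall {n} (Kall≋-resp (≋₆-sym (≈₆⇒≋₆ {s} {act σ (const6 P)} s≈)) (Kall≋-act σ (k , k , k)))
    where
      k : Kall₁ n κ (const6 P)
      k = fixed-point-Kall₁ P (+-cong (≈-refl {+ 8}) (≈-sym (mk≈ {κ} {+ 4} κ≈4))) refl refl refl


  private
    X₁-third : ∀ {s σ t} → s ≋₆ act σ t → ∃[ u ] proj₂ (proj₂ (X₁ s)) ≈ u • proj₂ (proj₂ (X₁ t))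
    X₁-third {σ = σ} {t} s≋ = let u , eq = act₃-third σ (X₁ t) in u , ≈-trans (e₃ (X₁≋ s≋)) (≡⇒≈ eq)

  orbit∩E≡∅ : ∀ {n κ s} → ¬ (InOrbitSet p (Tall p n κ) s × InE p n κ s)
  orbit∩E≡∅ {n} {κ} {s} ((α , β , σ , (β≉0 , A≈0 , _) , s≈) , s∈E) =
    let u , z≈uβ = X₁-third {σ = σ} {K α β} (≈₆⇒≋₆ {s} {act σ (K α β)} s≈) in excluded u z≈uβ s∈E
    where
      A½≈0 : A½ β n ≈ + 0
      A½≈0 = ≈-trans (≈-sym (A-half≈A½ prime 2<p n β)) (mk≈ A≈0)
      ±2-excluded : ∀ w → β ≈ w • + 2 → ¬ ¬ (+ (2 ℕ.* n ℕ.+ 1) ≡[ p ] + 0)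
      ±2-excluded ±.+ β≈2 2n+1≉0 =
        2n+1≉0 (un≈ (≈-trans (≡⇒≈ (sym (A½-at-two n))) (≈-trans (A½-cong n (≈-sym β≈2)) A½≈0)))
      ±2-excluded ±.- β≈-2 _ =
        let w , A≡ = A½-at-minus-two n
        in ±1≉0 1<p w (≈-trans (≡⇒≈ (sym A≡)) (≈-trans (A½-cong n (≈-sym β≈-2)) A½≈0))
      excluded : ∀ u → proj₂ (proj₂ (X₁ s)) ≈ u • β → ¬ InE p n κ s
      excluded u z≈uβ (inj₁ (_ , s≈O)) =
        β≉0 (un≈ (≈-trans (•-flip u (≈-trans (≈-sym (e₃ (X₁≋ (≈₆⇒≋₆ {s} {const6 O} s≈O)))) z≈uβ)) (•-zero u ≈-refl)))
      excluded u z≈uβ (inj₂ (_ , 2n+1≉0 , σ′ , s≈P)) =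
        let v , z≈v2 = X₁-third {σ = σ′} {const6 P} (≈₆⇒≋₆ {s} {act σ′ (const6 P)} s≈P)
        in ±2-excluded (u ±.* v) (≈-trans (•-flip u (≈-trans (≈-sym z≈v2) z≈uβ)) (≡⇒≈ (•-• u v (+ 2)))) 2n+1≉0

  private
    cubic-split : ∀ κ α β →
      β * β * (+ 3 - β) - κ ≡ (β - α) * (β - (β * β - α)) + (α * α - β * β * α + + 2 * β * β - κ)
    cubic-split = solve-∀

    quartic-split : ∀ κ α β →
      β * β * (+ 8 - β * β) - + 4 * κ ≡
      + 4 * (α * α - β * β * α + + 2 * β * β - κ) - (α - (β * β - α)) * (α - (β * β - α))
    quartic-split = solve-∀

  module _ (κ α β : ℤ) (f≈0 : f κ β α ≈ + 0) where

    cubic-condition : β * β * (+ 3 - β) ≈ κ ⇔ (β - α) * (β - (β * β - α)) ≈ + 0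
    cubic-condition = mk⇔
      (λ h → ≈-trans (≡⇒≈ (trans (add-sub _ (f κ β α)) (cong (_- f κ β α) (sym (cubic-split κ α β)))))
                     (minus-cong (≈⇒diff≈0 h) f≈0))
      (λ h → diff≈0⇒≈ (≈-trans (≡⇒≈ (cubic-split κ α β)) (+-cong h f≈0)))
      where
        add-sub : ∀ x y → x ≡ (x + y) - y
        add-sub = solve-∀

    quartic-condition : β * β * (+ 8 - β * β) ≈ + 4 * κ ⇔ (α - (β * β - α)) * (α - (β * β - α)) ≈ + 0
    quartic-condition = mk⇔
      (λ h → ≈-trans (≡⇒≈ (trans (sub-sub _ (+ 4 * f κ β α)) (cong (λ x → + 4 * f κ β α - x) (sym (quartic-split κ α β)))))
                     (minus-cong (*-cong (≈-refl {+ 4}) f≈0) (≈⇒diff≈0 h)))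
      (λ h → diff≈0⇒≈ (≈-trans (≡⇒≈ (quartic-split κ α β)) (minus-cong (*-cong (≈-refl {+ 4}) f≈0) h)))
      where
        sub-sub : ∀ x y → x ≡ y - (y - x)
        sub-sub = solve-∀

  private
    via-σ : ∀ σ {A B KA KB} → A ≋ act₃ σ KA → B ≋ act₃ σ KB → KA ≋ KB → A ≈₃[ p ] B
    via-σ σ A≋ B≋ KA≋KB = ≋⇒≈₃ (≋-trans A≋ (≋-trans (act₃-cong σ KA≋KB) (≋-sym B≋)))

    apart-via-σ : ∀ σ {A B KA KB} → A ≋ act₃ σ KA → B ≋ act₃ σ KB → ¬ (KA ≋ KB) → ¬ (A ≈₃[ p ] B)
    apart-via-σ σ {KA = KA} {KB} A≋ B≋ KA≉KB A≈B = KA≉KB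
      (≋-trans (≡⇒≋ (sym (act₃-involutive σ KA)))
        (≋-trans (act₃-cong σ (≋-trans (≋-sym A≋) (≋-trans (≈₃⇒≋ A≈B) B≋))) (≡⇒≋ (act₃-involutive σ KB))))

  Kdist⇒orbit : ∀ {n κ s} → Kdist p n κ s → InOrbitSet p (Tdist p n κ) s
  Kdist⇒orbit {n} {κ} {s} (k , ((X₁≉X₂ ∷ _ ∷ X₁≉Y₁ ∷ _) ∷ _ ∷ _ ∷ (Y₁≉Y₂ ∷ _) ∷ _)) =
    refine (Kall⇒orbit⊎E {n} {κ} {s} k)
    where
      X₁≉X₂-via : ∀ {t} → s ≋₆ t → X₁ t ≋ X₂ t → ⊥
      X₁≉X₂-via s≋ X₁≋X₂ = X₁≉X₂ (≋⇒≈₃ (≋-trans (X₁≋ s≋) (≋-trans X₁≋X₂ (≋-sym (X₂≋ s≋)))))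
      refine : InOrbitSet p (Tall p n κ) s ⊎ InE p n κ s → InOrbitSet p (Tdist p n κ) s
      refine (inj₂ (inj₁ (_ , s≈O))) = ⊥-elim (X₁≉X₂-via (≈₆⇒≋₆ {s} {const6 O} s≈O) ≋-refl)
      refine (inj₂ (inj₂ (_ , _ , σ , s≈P))) = ⊥-elim (X₁≉X₂-via (≈₆⇒≋₆ {s} {act σ (const6 P)} s≈P) ≋-refl)
      refine (inj₁ (α , β , σ , t@(_ , _ , f≈0) , s≈)) = α , β , σ , (t , not-cubic , not-quartic) , s≈
        where
          s≋ = ≈₆⇒≋₆ {s} {act σ (K α β)} s≈
          not-cubic : ¬ (β * β * (+ 3 - β) ≡[ p ] κ)
          not-cubic h = [ (λ β-α≈0 → let α≈β = ≈-sym (diff≈0⇒≈ β-α≈0) in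
                             X₁≉X₂ (via-σ σ (X₁≋ s≋) (X₂≋ s≋) (tri α≈β (≈-sym α≈β) ≈-refl)))
                        , (λ β-ᾱ≈0 → let ᾱ≈β = ≈-sym (diff≈0⇒≈ β-ᾱ≈0) in
                             Y₁≉Y₂ (via-σ σ (Y₁≋ s≋) (Y₂≋ s≋) (tri ᾱ≈β (≈-sym ᾱ≈β) ≈-refl))) ]′
            (x*y≈0⇒x≈0∨y≈0 prime (β - α) (β - (β * β - α))
              (Equivalence.to (cubic-condition κ α β (mk≈ f≈0)) (mk≈ h)))
          not-quartic : ¬ (β * β * (+ 8 - β * β) ≡[ p ] + 4 * κ)
          not-quartic h = [ α≉ᾱ , α≉ᾱ ]′
            (x*y≈0⇒x≈0∨y≈0 prime (α - (β * β - α)) (α - (β * β - α))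
              (Equivalence.to (quartic-condition κ α β (mk≈ f≈0)) (mk≈ h)))
            where
              α≉ᾱ : ¬ (α - (β * β - α) ≈ + 0)
              α≉ᾱ α-ᾱ≈0 = X₁≉Y₁ (via-σ σ (X₁≋ s≋) (Y₁≋ s≋) (tri (diff≈0⇒≈ α-ᾱ≈0) ≈-refl ≈-refl))

  orbit⇒Kdist : ∀ {n κ s} → InOrbitSet p (Tdist p n κ) s → Kdist p n κ s
  orbit⇒Kdist {n} {κ} {s} (α , β , σ , (t@(_ , _ , f≈0) , not-cubic , not-quartic) , s≈) =
    orbit⊎E⇒Kall {n} {κ} {s} (inj₁ (α , β , σ , t , s≈)) ,
    ( (apart X₁≋ X₂≋ (α≉β ∘′ e₁) ∷ apart X₁≋ X₃≋ (α≉β ∘′ e₁) ∷ apart X₁≋ Y₁≋ (α≉ᾱ ∘′ e₁) ∷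
       apart X₁≋ Y₂≋ (α≉β ∘′ e₁) ∷ apart X₁≋ Y₃≋ (α≉β ∘′ e₁) ∷ []) ∷
      (apart X₂≋ X₃≋ (α≉β ∘′ e₂) ∷ apart X₂≋ Y₁≋ (ᾱ≉β ∘′ ≈-sym ∘′ e₁) ∷ apart X₂≋ Y₂≋ (α≉ᾱ ∘′ e₂) ∷
       apart X₂≋ Y₃≋ (α≉β ∘′ e₂) ∷ []) ∷
      (apart X₃≋ Y₁≋ (ᾱ≉β ∘′ ≈-sym ∘′ e₁) ∷ apart X₃≋ Y₂≋ (ᾱ≉β ∘′ ≈-sym ∘′ e₂) ∷
       apart X₃≋ Y₃≋ (α≉ᾱ ∘′ e₃) ∷ []) ∷
      (apart Y₁≋ Y₂≋ (ᾱ≉β ∘′ e₁) ∷ apart Y₁≋ Y₃≋ (ᾱ≉β ∘′ e₁) ∷ []) ∷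
      (apart Y₂≋ Y₃≋ (ᾱ≉β ∘′ e₂) ∷ []) ∷ [] ∷ [] )
    where
      s≋ = ≈₆⇒≋₆ {s} {act σ (K α β)} s≈
      apart : ∀ {A B KA KB} → (s ≋₆ act σ (K α β) → A ≋ act₃ σ KA) → (s ≋₆ act σ (K α β) → B ≋ act₃ σ KB) →
        ¬ (KA ≋ KB) → ¬ (A ≈₃[ p ] B)
      apart A≋ B≋ = apart-via-σ σ (A≋ s≋) (B≋ s≋)
      cubic = cubic-condition κ α β (mk≈ f≈0)
      α≉β : ¬ (α ≈ β)
      α≉β α≈β = not-cubic (un≈ (Equivalence.from cubic
        (≈-trans (*-cong (≈⇒diff≈0 (≈-sym α≈β)) ≈-refl) (≡⇒≈ (zero-times (β - (β * β - α)))))))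
        where
          zero-times : ∀ x → + 0 * x ≡ + 0
          zero-times = solve-∀
      ᾱ≉β : ¬ (β * β - α ≈ β)
      ᾱ≉β ᾱ≈β = not-cubic (un≈ (Equivalence.from cubic
        (≈-trans (*-cong (≈-refl {β - α}) (≈⇒diff≈0 (≈-sym ᾱ≈β))) (≡⇒≈ (times-zero (β - α))))))
        where
          times-zero : ∀ x → x * + 0 ≡ + 0
          times-zero = solve-∀
      α≉ᾱ : ¬ (α ≈ β * β - α)
      α≉ᾱ α≈ᾱ = not-quartic (un≈ (Equivalence.from (quartic-condition κ α β (mk≈ f≈0))
        (≈-trans (*-cong (≈⇒diff≈0 α≈ᾱ) (≈⇒diff≈0 α≈ᾱ)) ≈-refl)))

theorem3p6 : (κ : ℤ) (p : ℕ) → Prime p → 3 < p → (n : ℕ) → 0 < n →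
    ((s : Sextuple) →
      Kall p n κ s ⇔ (InOrbitSet p (Tall p n κ) s ⊎ InE p n κ s))
    × ((s : Sextuple) → ¬ (InOrbitSet p (Tall p n κ) s × InE p n κ s))
    × ((s : Sextuple) → Kdist p n κ s ⇔ InOrbitSet p (Tdist p n κ) s)
theorem3p6 κ p p-prime 3<p n _ =
  (λ s → mk⇔ (Kall⇒orbit⊎E {n} {κ} {s}) (orbit⊎E⇒Kall {n} {κ} {s})) ,
  (λ s → orbit∩E≡∅ {n} {κ} {s}) ,
  (λ s → mk⇔ (Kdist⇒orbit {n} {κ} {s}) (orbit⇒Kdist {n} {κ} {s}))
  where open Classification p p-prime (ℕₚ.<-trans (ℕₚ.n<1+n 2) 3<p)
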